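{- Each of the games $W^2$ and $W^3$ has no redundant move: for every single move $m\in\{(i,0),(0,i),(i,i): i\ge 1\}$, removing $m$ from the rule-set of $W^2$ (respectively $W^3$) changes the set of $\mathcal{P}$-positions.
   Context: Positions are pairs $(x,y)\in\mathbb{N}^2$. The rule-set of Wythoff moves is $\{(i,0),(0,i),(i,i): i\ge1\}$; playing move $(u,v)$ from $(x,y)$ leads to $(x-u,y-v)$ provided both coordinates remain nonnegative; the options of a position are the positions reachable in one move. For $k\ge1$, in the game $W^k$ two players alternate moves; before each move, the player who has just moved may declare at most $k-1$ of the options of the current position forbidden, and the player about to move must then move to a non-forbidden option; the prohibition has no effect on later moves. Normal play: a player unable to move loses. A $\mathcal{P}$-position is a position from which the previous player has a winning strategy. A move is redundant if removing it from the rule-set does not change the set of $\mathcal{P}$-positions. -}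

module Defs where

open import Data.Nat using (ℕ; zero; suc; _≤_; _∸_)
open import Data.Product using (_×_; _,_; Σ; ∃)
open import Data.Sum using (_⊎_)
open import Data.List using (List; length)
open import Data.List.Relation.Unary.All using (All)
open import Data.List.Membership.Propositional using (_∈_; _∉_)
open import Relation.Binary.PropositionalEquality using (_≡_; _≢_)
open import Relation.Nullary using (¬_)

Pos : Set
Pos = ℕ × ℕ

Move : Set
Move = ℕ × ℕ

RuleSet : Set₁
RuleSet = Move → Set

Wythoff : RuleSet
Wythoff (u , v) = (1 ≤ u × v ≡ 0) ⊎ (u ≡ 0 × 1 ≤ v) ⊎ (1 ≤ u × u ≡ v)

remove : RuleSet → Move → RuleSet
remove R m mv = R mv × mv ≢ m

Option : RuleSet → Pos → Pos → Set
Option R (x , y) q =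
  Σ Move λ { (u , v) → R (u , v) × u ≤ x × v ≤ y × q ≡ (x ∸ u , y ∸ v) }

-- A forbidden declaration at p in W^k: a list of at most k-1 options of p.
Forbidden : RuleSet → ℕ → Pos → List Pos → Set
Forbidden R k p F = length F ≤ k ∸ 1 × All (Option R p) F

-- Winning strategies in the game W^k with rule-set R (normal play),
-- as well-founded inductive game trees.
--   PrevWins R k p : the previous player (who just moved to p, and now
--     declares the forbidden options) has a winning strategy from p.
--   NextWins R k p : the player about to move from p has a winning
--     strategy (whatever the opponent forbids).
mutual
  data PrevWins (R : RuleSet) (k : ℕ) (p : Pos) : Set where
    prev : (F : List Pos) → Forbidden R k p F →
           (∀ q → Option R p q → q ∉ F → NextWins R k q) →
           PrevWins R k p

  data NextWins (R : RuleSet) (k : ℕ) (p : Pos) : Set where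
    next : (∀ F → Forbidden R k p F →
              Σ Pos λ q → Option R p q × q ∉ F × PrevWins R k q) →
           NextWins R k p

IsP : RuleSet → ℕ → Pos → Set
IsP = PrevWins

-- Move m is redundant in W^k (rule-set R) iff removing it does not change
-- the set of P-positions.  Its negation, stated positively: some position
-- lies in exactly one of the two P-position sets.
PSetsDiffer : RuleSet → RuleSet → ℕ → Set
PSetsDiffer R R' k =
  ∃ λ p → (IsP R k p × ¬ IsP R' k p) ⊎ (¬ IsP R k p × IsP R' k p)

-- In W^k a position is a P-position exactly when at most k - 1 of its options are
-- P-positions, since the previous player can forbid all of them.  The P-positions
-- of W³ are (0,0), (n, 2n+1) and (n, 2n+2); those of W² are (0,0), (n, 2n+1) and
-- (2a+2, 2b+2) for (a,b) a P-position of Wythoff's game; in both cases together with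
-- their mirror images.  Both descriptions are verified by counting, for every
-- position, the candidate P-positions to its left, below it and diagonally below it.
--
-- A move m is then not redundant because some position p has exactly k P-options,
-- one of them p - m: p is an N-position, but without m only k - 1 P-options are left
-- and p becomes a P-position, unless one of its options has already changed status.
-- For the diagonal moves of W² the choice of p uses that among c, c + 1 and among
-- t, t + 2, t + 4 there is always a lower Wythoff number A_j with j ≥ 1.

module Submission where

open import Defs
open import Data.Bool using (Bool; true; false; if_then_else_)
open import Data.Empty using (⊥; ⊥-elim)
open import Data.Nat using (ℕ; zero; suc; _+_; _∸_; _≤_; _<_; z≤n; s≤s; _≟_; _≤?_; _<?_; _<ᵇ_; ⌊_/2⌋)
open import Data.Nat.Induction using (<-wellFounded)
open import Data.Nat.Properties
open import Data.Nat.Tactic.RingSolver using (solve-∀)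
open import Data.Product using (∃-syntax; _×_; _,_; proj₁; proj₂; uncurry; map₂)
open import Data.Product.Properties using (≡-dec; ,-injectiveˡ; ,-injectiveʳ)
open import Data.Sum using (_⊎_; inj₁; inj₂; [_,_]′)
open import Data.Unit using (tt)
open import Data.List using (List; []; _∷_; _++_; length; filter; map; cartesianProduct; upTo; deduplicate)
open import Data.List.Extrema.Nat using (max; xs≤max)
open import Data.List.Properties using (filter-notAll; length-++; length-map)
open import Data.List.Relation.Unary.All using ([]; _∷_; lookup; tabulate)
open import Data.List.Relation.Unary.Any using (Any; here; there; any?)
open import Data.List.Relation.Unary.Unique.Propositional using (Unique; []; _∷_)
open import Data.List.Relation.Unary.Unique.Propositional.Properties using (map⁺; ++⁺; filter⁺)
open import Data.List.Relation.Unary.Unique.DecPropositional.Properties using (deduplicate-!)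
open import Data.List.Relation.Binary.Disjoint.Propositional using (Disjoint)
open import Data.List.Relation.Binary.Subset.Propositional using (_⊆_)
open import Data.List.Membership.Propositional using (_∈_; _∉_; find; lose)
open import Data.List.Membership.Propositional.Properties
  using (∈-filter⁺; ∈-filter⁻; ∈-map⁺; ∈-map⁻; ∈-cartesianProduct⁺; ∈-cartesianProduct⁻; ∈-upTo⁺; ∈-upTo⁻;
         ∈-deduplicate⁺; ∈-deduplicate⁻; ∈-++⁺ˡ; ∈-++⁺ʳ; ∈-++⁻)
open import Function using (_∘_; _$_; id; flip)
import Induction.WellFounded as WF
import Relation.Binary.Construct.On as On
open import Relation.Binary.Definitions using (DecidableEquality; tri<; tri≈; tri>)
open import Relation.Binary.PropositionalEquality
  using (_≡_; _≢_; refl; sym; trans; subst; subst₂; cong; cong₂; module ≡-Reasoning)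
open import Relation.Nullary using (¬_; ¬?; Dec; yes; no; contradiction; _×-dec_; _⊎-dec_)
open import Relation.Nullary.Decidable using (decidable-stable; map′)
open import Relation.Unary using (Decidable)

module Pigeonhole {A : Set} (_≟_ : DecidableEquality A) where

  open import Data.List.Membership.DecPropositional _≟_ using (_∈?_)

  unique-⊆⇒length-≤ : ∀ {xs ys : List A} → Unique xs → xs ⊆ ys → length xs ≤ length ys
  unique-⊆⇒length-≤ [] _ = z≤n
  unique-⊆⇒length-≤ {x ∷ xs} {ys} (x≢xs ∷ xs!) x∷xs⊆ys =
    ≤-<-trans (unique-⊆⇒length-≤ xs! xs⊆others)
              (filter-notAll (¬? ∘ (_≟ x)) ys (lose (x∷xs⊆ys (here refl)) (λ x≢x → x≢x refl)))
    where
      xs⊆others : xs ⊆ filter (¬? ∘ (_≟ x)) ys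
      xs⊆others y∈xs = ∈-filter⁺ (¬? ∘ (_≟ x)) (x∷xs⊆ys (there y∈xs)) (λ { refl → lookup x≢xs y∈xs refl })

  pigeonhole : ∀ {xs ys : List A} → Unique xs → length ys < length xs → ∃[ z ] z ∈ xs × z ∉ ys
  pigeonhole {xs} {ys} xs! |ys|<|xs| with any? (¬? ∘ (_∈? ys)) xs
  ... | yes missing = find missing
  ... | no ¬missing = contradiction (unique-⊆⇒length-≤ xs! xs⊆ys) (<⇒≱ |ys|<|xs|)
    where
      xs⊆ys : xs ⊆ ys
      xs⊆ys {z} z∈xs = decidable-stable (z ∈? ys) (¬missing ∘ lose z∈xs)

_≟ₚ_ : DecidableEquality Pos
_≟ₚ_ = ≡-dec _≟_ _≟_

open Pigeonhole _≟ₚ_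

record Listing (P : Pos → Set) : Set where
  field
    elements : List Pos
    unique   : Unique elements
    sound    : ∀ {q} → q ∈ elements → P q
    complete : ∀ {q} → P q → q ∈ elements

open Listing

Characterises : RuleSet → ℕ → (Pos → Set) → Pos → Set
Characterises R k Q p = (Q p → PrevWins R k p) × (¬ Q p → NextWins R k p)

prev⇒¬next : ∀ {R k p} → PrevWins R k p → ¬ NextWins R k p
prev⇒¬next (prev F F-ok escape) (next win) with win F F-ok
... | q , q-option , q∉F , prev-q = prev⇒¬next prev-q (escape q q-option q∉F)

-- b is the number of options the previous player may forbid: the game is W^(b+1).
module _ {R : RuleSet} {b : ℕ} {p : Pos} {Q : Pos → Set}
         (Q-options : Listing (λ q → Option R p q × Q q))
         (options-characterised : ∀ {q} → Option R p q → Characterises R (suc b) Q q) where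

  few-Q-options⇒prev : length (elements Q-options) ≤ b → PrevWins R (suc b) p
  few-Q-options⇒prev few =
    prev (elements Q-options) (few , tabulate (proj₁ ∘ sound Q-options))
         (λ q q-option q∉ → proj₂ (options-characterised q-option) (q∉ ∘ complete Q-options ∘ (q-option ,_)))

  many-Q-options⇒next : b < length (elements Q-options) → NextWins R (suc b) p
  many-Q-options⇒next many = next λ F (few , _) →
    let z , z∈ , z∉F = pigeonhole (unique Q-options) (≤-<-trans few many)
        z-option , Q-z = sound Q-options z∈
    in  z , z-option , z∉F , proj₁ (options-characterised z-option) Q-z

determined⇒characterises : ∀ {R k q} → PrevWins R k q ⊎ NextWins R k q → Characterises R k (PrevWins R k) q
determined⇒characterises determined-q = id , λ ¬prev-q → [ flip contradiction ¬prev-q , id ]′ determined-q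

NonNull : RuleSet → Set
NonNull R = ∀ {u v} → R (u , v) → 1 ≤ u + v

size : Pos → ℕ
size (x , y) = x + y

option-shrinks : ∀ {R p q} → NonNull R → Option R p q → size q < size p
option-shrinks {p = x , y} nonnull ((zero , v) , r , _ , v≤y , refl) = +-monoʳ-< x (∸-monoʳ-< (nonnull r) v≤y)
option-shrinks {p = x , y} nonnull ((suc u , v) , r , u<x , _ , refl) = +-mono-<-≤ (∸-monoʳ-< (s≤s z≤n) u<x) (m∸n≤m y v)

option-rec : ∀ {R} → NonNull R → (P : Pos → Set) →
             (∀ p → (∀ {q} → Option R p q → P q) → P p) → ∀ p → P p
option-rec nonnull P step =
  WF.All.wfRec (On.wellFounded size <-wellFounded) _ P (λ p rec → step p (rec ∘ option-shrinks nonnull))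

module _ {R : RuleSet} (R? : Decidable R) where

  options : Pos → List Pos
  options (x , y) = map (λ (u , v) → (x ∸ u , y ∸ v)) (filter R? (cartesianProduct (upTo (suc x)) (upTo (suc y))))

  ∈-options⁺ : ∀ {p q} → Option R p q → q ∈ options p
  ∈-options⁺ ((u , v) , r , u≤x , v≤y , refl) =
    ∈-map⁺ _ (∈-filter⁺ R? (∈-cartesianProduct⁺ (∈-upTo⁺ (s≤s u≤x)) (∈-upTo⁺ (s≤s v≤y))) r)

  ∈-options⁻ : ∀ {p q} → q ∈ options p → Option R p q
  ∈-options⁻ {x , y} q∈ with (u , v) , mv∈ , refl ← ∈-map⁻ _ q∈ =
    let mv∈box , r = ∈-filter⁻ R? mv∈
        u∈ , v∈ = ∈-cartesianProduct⁻ (upTo (suc x)) (upTo (suc y)) mv∈box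
    in  (u , v) , r , ≤-pred (∈-upTo⁻ u∈) , ≤-pred (∈-upTo⁻ v∈) , refl

  option? : ∀ p q → Dec (Option R p q)
  option? p q = map′ ∈-options⁻ ∈-options⁺ (q ∈? options p)
    where open import Data.List.Membership.DecPropositional _≟ₚ_ using (_∈?_)

  module _ (nonnull : NonNull R) (b : ℕ) where

    prev-options : ∀ {p} → (∀ {q} → Option R p q → PrevWins R (suc b) q ⊎ NextWins R (suc b) q) →
                   Listing (λ q → Option R p q × PrevWins R (suc b) q)
    prev-options {p} determined-below = record
      { elements = deduplicate _≟ₚ_ (filter prev-option? (options p))
      ; unique   = deduplicate-! _≟ₚ_ _
      ; sound    = proj₂ ∘ ∈-filter⁻ prev-option? {xs = options p} ∘ ∈-deduplicate⁻ _≟ₚ_ (filter prev-option? (options p))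
      ; complete = λ (q-option , prev-q) →
          ∈-deduplicate⁺ _≟ₚ_ (∈-filter⁺ prev-option? (∈-options⁺ q-option) (q-option , prev-q))
      }
      where
        prev-option? : Decidable (λ q → Option R p q × PrevWins R (suc b) q)
        prev-option? q with option? p q
        ... | no ¬q-option = no (¬q-option ∘ proj₁)
        ... | yes q-option with determined-below q-option
        ...   | inj₁ prev-q = yes (q-option , prev-q)
        ...   | inj₂ next-q = no λ (_ , prev-q) → prev⇒¬next prev-q next-q

    -- Opaque because unfolding the well-founded recursion makes checking its uses blow up.
    opaque
      determined : ∀ p → PrevWins R (suc b) p ⊎ NextWins R (suc b) p
      determined = option-rec nonnull _ λ p determined-below →
        let listing = prev-options determined-below
            characterised = λ {q} → determined⇒characterises {q = q} ∘ determined-below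
        in  [ inj₁ ∘ few-Q-options⇒prev listing characterised
            , inj₂ ∘ many-Q-options⇒next listing characterised ]′ (≤-<-connex (length (elements listing)) b)

    prev? : ∀ p → Dec (PrevWins R (suc b) p)
    prev? p = [ yes , no ∘ flip prev⇒¬next ]′ (determined p)

module _ {R : RuleSet} (nonnull : NonNull R) {b : ℕ} {Q : Pos → Set}
         (Q-options : ∀ p → Listing (λ q → Option R p q × Q q))
         (Q⇒few : ∀ p → Q p → length (elements (Q-options p)) ≤ b)
         (¬Q⇒many : ∀ p → ¬ Q p → b < length (elements (Q-options p))) where

  characterised-by-counting : ∀ p → Characterises R (suc b) Q p
  characterised-by-counting = option-rec nonnull _ λ p below →
    few-Q-options⇒prev (Q-options p) below ∘ Q⇒few p , many-Q-options⇒next (Q-options p) below ∘ ¬Q⇒many p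

characterisation⇒sound : ∀ {R k Q p} → Dec (Q p) → Characterises R k Q p → PrevWins R k p → Q p
characterisation⇒sound Q-p? (_ , ¬Q⇒next) prev-p = decidable-stable Q-p? (prev⇒¬next prev-p ∘ ¬Q⇒next)

module _ {R : RuleSet} (R? : Decidable R) (nonnull : NonNull R) {b : ℕ} {x y u v : ℕ} where

  private
    m = (u , v)
    p = (x , y)
    R′ = remove R m

    R′? : Decidable R′
    R′? mv = R? mv ×-dec ¬? (mv ≟ₚ m)

    nonnull′ : NonNull R′
    nonnull′ = nonnull ∘ proj₁

    Prev = PrevWins R (suc b)
    Prev′ = PrevWins R′ (suc b)

  prev-after-removal :
    R m → u ≤ x → v ≤ y → Prev (x ∸ u , y ∸ v) →
    (P-options : Listing (λ q → Option R p q × Prev q)) → length (elements P-options) ≡ suc b →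
    (∀ {q} → Option R′ p q → Prev′ q → Prev q) → Prev′ p
  prev-after-removal r u≤x v≤y prev-target P-options |P-options|≡1+b stays-prev =
    prev others (|others|≤b , tabulate other-option) escape
    where
      target = (x ∸ u , y ∸ v)
      others = filter (¬? ∘ (_≟ₚ target)) (elements P-options)

      |others|≤b : length others ≤ b
      |others|≤b = ≤-pred (subst (length others <_) |P-options|≡1+b
        (filter-notAll _ _ (lose (complete P-options ((m , r , u≤x , v≤y , refl) , prev-target)) (λ ¬≡ → ¬≡ refl))))

      other-option : ∀ {q} → q ∈ others → Option R′ p q
      other-option q∈ with ∈-filter⁻ _ {xs = elements P-options} q∈
      ... | q∈P , q≢target with sound P-options q∈P
      ...   | (mv , r′ , u′≤x , v′≤y , refl) , _ = mv , (r′ , λ { refl → q≢target refl }) , u′≤x , v′≤y , refl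

      escape : ∀ q → Option R′ p q → q ∉ others → NextWins R′ (suc b) q
      escape q q-option′@((u′ , v′) , (r′ , mv≢m) , u′≤x , v′≤y , refl) q∉ with determined R′? nonnull′ b q
      ... | inj₂ next′-q = next′-q
      ... | inj₁ prev′-q = contradiction (∈-filter⁺ _ q∈P q≢target) q∉
        where
          q∈P : q ∈ elements P-options
          q∈P = complete P-options (((u′ , v′) , r′ , u′≤x , v′≤y , refl) , stays-prev q-option′ prev′-q)
          q≢target : q ≢ target
          q≢target q≡target = mv≢m (cong₂ _,_ (∸-cancelˡ-≡ u′≤x u≤x (,-injectiveˡ q≡target))
                                              (∸-cancelˡ-≡ v′≤y v≤y (,-injectiveʳ q≡target)))

  removal-changes-P-positions :
    R m → u ≤ x → v ≤ y → Prev (x ∸ u , y ∸ v) →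
    (P-options : Listing (λ q → Option R p q × Prev q)) → length (elements P-options) ≡ suc b →
    PSetsDiffer R R′ (suc b)
  removal-changes-P-positions r u≤x v≤y prev-target P-options |P-options|≡1+b
    with any? (λ q → prev? R′? nonnull′ b q ×-dec ¬? (prev? R? nonnull b q)) (options R′? p)
  ... | yes gained = let q , _ , prev′-q , ¬prev-q = find gained in q , inj₂ (¬prev-q , prev′-q)
  ... | no ¬gained = p , inj₂ (¬prev-p , prev-after-removal r u≤x v≤y prev-target P-options |P-options|≡1+b stays-prev)
    where
      ¬prev-p : ¬ Prev p
      ¬prev-p prev-p = prev⇒¬next prev-p
        (many-Q-options⇒next P-options (λ {q} _ → determined⇒characterises (determined R? nonnull b q))
                             (≤-reflexive (sym |P-options|≡1+b)))
      stays-prev : ∀ {q} → Option R′ p q → Prev′ q → Prev q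
      stays-prev {q} q-option′ prev′-q = decidable-stable (prev? R? nonnull b q)
        (λ ¬prev-q → ¬gained (lose (∈-options⁺ R′? q-option′) (prev′-q , ¬prev-q)))

𝟙[_<_] : ℕ → ℕ → ℕ
𝟙[ a < x ] = if a <ᵇ x then 1 else 0

#below : ℕ → List ℕ → ℕ
#below x [] = 0
#below x (a ∷ as) = 𝟙[ a < x ] + #below x as

#below-0 : ∀ as → #below 0 as ≡ 0
#below-0 [] = refl
#below-0 (a ∷ as) = #below-0 as

below : ℕ → List ℕ → List ℕ
below x = filter (_<? x)

length-below : ∀ x as → length (below x as) ≡ #below x as
length-below x [] = refl
length-below x (a ∷ as) with a <ᵇ x
... | true = cong suc (length-below x as)
... | false = length-below x as

𝟙[<]≡1 : ∀ {a x} → a < x → 𝟙[ a < x ] ≡ 1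
𝟙[<]≡1 {a} {x} a<x with a <ᵇ x | <⇒<ᵇ a<x
... | true | _ = refl

𝟙[<]≡0 : ∀ {a x} → x ≤ a → 𝟙[ a < x ] ≡ 0
𝟙[<]≡0 {a} {x} x≤a with a <ᵇ x | <ᵇ⇒< a x
... | false | _ = refl
... | true | a<x = contradiction (a<x tt) (≤⇒≯ x≤a)

𝟙[<]≤1 : ∀ a x → 𝟙[ a < x ] ≤ 1
𝟙[<]≤1 a x with a <ᵇ x
... | true = ≤-refl
... | false = z≤n

𝟙[<]≥1 : ∀ {a x} → a < x → 1 ≤ 𝟙[ a < x ]
𝟙[<]≥1 = ≤-reflexive ∘ sym ∘ 𝟙[<]≡1

𝟙[<]≤0 : ∀ {a x} → x ≤ a → 𝟙[ a < x ] ≤ 0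
𝟙[<]≤0 = ≤-reflexive ∘ 𝟙[<]≡0

#below-head : ∀ {a x} as → a < x → 1 ≤ #below x (a ∷ as)
#below-head as a<x = ≤-trans (𝟙[<]≥1 a<x) (m≤m+n _ (#below _ as))

double : ℕ → ℕ
double n = n + n

⌊double/2⌋ : ∀ n → ⌊ double n /2⌋ ≡ n
⌊double/2⌋ zero = refl
⌊double/2⌋ (suc n) rewrite +-suc n n = cong suc (⌊double/2⌋ n)

⌊1+double/2⌋ : ∀ n → ⌊ suc (double n) /2⌋ ≡ n
⌊1+double/2⌋ zero = refl
⌊1+double/2⌋ (suc n) rewrite +-suc n n = cong suc (⌊1+double/2⌋ n)

data Parity : ℕ → Set where
  even : ∀ n → Parity (double n)
  odd  : ∀ n → Parity (suc (double n))

parity : ∀ n → Parity n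
parity zero = even zero
parity (suc n) with parity n
... | even m = odd m
... | odd m = subst Parity (cong suc (+-suc m m)) (even (suc m))

isEven : ℕ → Bool
isEven zero = true
isEven (suc zero) = false
isEven (suc (suc n)) = isEven n

isEven-double : ∀ n → isEven (double n) ≡ true
isEven-double zero = refl
isEven-double (suc n) rewrite +-suc n n = isEven-double n

isEven-1+double : ∀ n → isEven (suc (double n)) ≡ false
isEven-1+double zero = refl
isEven-1+double (suc n) rewrite +-suc n n = isEven-1+double n

double≢1+double : ∀ p q → double p ≢ suc (double q)
double≢1+double p q eq with trans (sym (isEven-double p)) (trans (cong isEven eq) (isEven-1+double q))
... | ()

2+double≢1+double : ∀ p q → suc (suc (double p)) ≢ suc (double q)
2+double≢1+double p q eq = double≢1+double (suc p) q (trans (cong suc (+-suc p p)) eq)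

double-cancel-≤ : ∀ {p q} → double p ≤ double q → p ≤ q
double-cancel-≤ {p} {q} 2p≤2q with p ≤? q
... | yes p≤q = p≤q
... | no p≰q = contradiction 2p≤2q (<⇒≱ (+-mono-< (≰⇒> p≰q) (≰⇒> p≰q)))

double-injective : ∀ {p q} → double p ≡ double q → p ≡ q
double-injective eq = ≤-antisym (double-cancel-≤ (≤-reflexive eq)) (double-cancel-≤ (≤-reflexive (sym eq)))

double-mono-≤ : ∀ {p q} → p ≤ q → double p ≤ double q
double-mono-≤ p≤q = +-mono-≤ p≤q p≤q

double-mono-< : ∀ {p q} → p < q → double p < double q
double-mono-< p<q = +-mono-< p<q p<q

data Shape : ℕ → Set where
  zero  : Shape 0
  odd   : ∀ n → Shape (suc (double n))
  even⁺ : ∀ b → Shape (suc (suc (double b)))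

shape : ∀ y → Shape y
shape zero = zero
shape (suc y) with shape y
... | zero = odd 0
... | odd n = even⁺ n
... | even⁺ b = subst Shape (cong (suc ∘ suc) (+-suc b b)) (odd (suc b))

∈-pair⁻ : ∀ {x a b : ℕ} → x ∈ a ∷ b ∷ [] → x ≡ a ⊎ x ≡ b
∈-pair⁻ (here x≡a) = inj₁ x≡a
∈-pair⁻ (there (here x≡b)) = inj₂ x≡b

wythoff? : Decidable Wythoff
wythoff? (u , v) = (1 ≤? u ×-dec v ≟ 0) ⊎-dec (u ≟ 0 ×-dec 1 ≤? v) ⊎-dec (1 ≤? u ×-dec u ≟ v)

wythoff-nonnull : NonNull Wythoff
wythoff-nonnull {u} {v} (inj₁ (1≤u , _)) = ≤-trans 1≤u (m≤m+n u v)
wythoff-nonnull {u} {v} (inj₂ (inj₁ (_ , 1≤v))) = ≤-trans 1≤v (m≤n+m v u)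
wythoff-nonnull {u} {v} (inj₂ (inj₂ (1≤u , _))) = ≤-trans 1≤u (m≤m+n u v)

-- A symmetric set Q of positions given by its rows, row y listing the x with (x, y) ∈ Q,
-- and its diagonals, diag d listing the a with (a, a + d) ∈ Q.
module RowDiagonalSet
  (row diag : ℕ → List ℕ)
  (row-sym : ∀ {x y} → x ∈ row y → y ∈ row x)
  (diag⇒row : ∀ {a d} → a ∈ diag d → a ∈ row (a + d))
  (row⇒diag : ∀ {a d} → a ∈ row (a + d) → a ∈ diag d)
  (row-unique : ∀ y → Unique (row y))
  (diag-unique : ∀ d → Unique (diag d)) where

  Q : Pos → Set
  Q (x , y) = x ∈ row y

  Q? : Decidable Q
  Q? (x , y) = x ∈? row y
    where open import Data.List.Membership.DecPropositional _≟_ using (_∈?_)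

  row-options column-options : Pos → List Pos
  row-options (x , y) = map (_, y) (below x (row y))
  column-options (x , y) = map (x ,_) (below y (row x))

  diagonal-options : ∀ x y → Dec (x ≤ y) → List Pos
  diagonal-options x y (yes _) = map (λ a → a , a + (y ∸ x)) (below x (diag (y ∸ x)))
  diagonal-options x y (no _) = map (λ a → a + (x ∸ y) , a) (below y (diag (x ∸ y)))

  Q-option-list : Pos → List Pos
  Q-option-list (x , y) = row-options (x , y) ++ column-options (x , y) ++ diagonal-options x y (x ≤? y)

  diagonal-count : ∀ x y → Dec (x ≤ y) → ℕ
  diagonal-count x y (yes _) = #below x (diag (y ∸ x))
  diagonal-count x y (no _) = #below y (diag (x ∸ y))

  count : Pos → ℕ
  count (x , y) = #below x (row y) + #below y (row x) + diagonal-count x y (x ≤? y)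

  length-Q-option-list : ∀ p → length (Q-option-list p) ≡ count p
  length-Q-option-list (x , y) = begin
    length (rows ++ columns ++ diagonals)              ≡⟨ length-++ rows ⟩
    length rows + length (columns ++ diagonals)        ≡⟨ cong (length rows +_) (length-++ columns) ⟩
    length rows + (length columns + length diagonals)  ≡⟨ +-assoc (length rows) _ _ ⟨
    length rows + length columns + length diagonals    ≡⟨ cong₂ _+_ (cong₂ _+_ (length-map-below _ x (row y)) (length-map-below _ y (row x)))
                                                                    (length-diagonal-options (x ≤? y)) ⟩
    count (x , y)                                      ∎
    where
      open ≡-Reasoning
      rows = row-options (x , y)
      columns = column-options (x , y)
      diagonals = diagonal-options x y (x ≤? y)
      length-map-below : ∀ (f : ℕ → Pos) x as → length (map f (below x as)) ≡ #below x as
      length-map-below f x as = trans (length-map f (below x as)) (length-below x as)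
      length-diagonal-options : ∀ x≤?y → length (diagonal-options x y x≤?y) ≡ diagonal-count x y x≤?y
      length-diagonal-options (yes _) = length-map-below _ x (diag (y ∸ x))
      length-diagonal-options (no _) = length-map-below _ y (diag (x ∸ y))

  private
    ∸-split : ∀ {u x y} → u ≤ x → x ≤ y → y ∸ u ≡ (x ∸ u) + (y ∸ x)
    ∸-split {u} {x} {y} u≤x x≤y = trans (cong (_∸ u) (sym (m+[n∸m]≡n x≤y))) (+-∸-comm (y ∸ x) u≤x)

    ∈-below⁻ : ∀ {a x as} → a ∈ below x as → a ∈ as × a < x
    ∈-below⁻ {x = x} {as} = ∈-filter⁻ (_<? x) {xs = as}

    ∈-below⁺ : ∀ {a x as} → a ∈ as → a < x → a ∈ below x as
    ∈-below⁺ {x = x} = ∈-filter⁺ (_<? x)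

  ∈-Q-option-list⁻ : ∀ {p q} → q ∈ Q-option-list p → Option Wythoff p q × Q q
  ∈-Q-option-list⁻ {x , y} q∈ with ∈-++⁻ (row-options (x , y)) q∈
  ... | inj₁ q∈rows with r , r∈ , refl ← ∈-map⁻ _ q∈rows with r∈row , r<x ← ∈-below⁻ r∈ =
    ((x ∸ r , 0) , inj₁ (m<n⇒0<n∸m r<x , refl) , m∸n≤m x r , z≤n , cong (_, y) (sym (m∸[m∸n]≡n (<⇒≤ r<x)))) , r∈row
  ... | inj₂ q∈rest with ∈-++⁻ (column-options (x , y)) q∈rest
  ...   | inj₁ q∈columns with c , c∈ , refl ← ∈-map⁻ _ q∈columns with c∈row , c<y ← ∈-below⁻ c∈ =
    ((0 , y ∸ c) , inj₂ (inj₁ (refl , m<n⇒0<n∸m c<y)) , z≤n , m∸n≤m y c , cong (x ,_) (sym (m∸[m∸n]≡n (<⇒≤ c<y)))) , row-sym c∈row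
  ...   | inj₂ q∈diagonals = diagonal (x ≤? y) q∈diagonals
    where
      diagonal : ∀ {q} x≤?y → q ∈ diagonal-options x y x≤?y → Option Wythoff (x , y) q × Q q
      diagonal (yes x≤y) q∈ with a , a∈ , refl ← ∈-map⁻ _ q∈ with a∈diag , a<x ← ∈-below⁻ a∈ =
        ((x ∸ a , x ∸ a) , inj₂ (inj₂ (m<n⇒0<n∸m a<x , refl)) , m∸n≤m x a , ≤-trans (m∸n≤m x a) x≤y ,
         sym (cong₂ _,_ (m∸[m∸n]≡n (<⇒≤ a<x)) (trans (∸-split (m∸n≤m x a) x≤y) (cong (_+ (y ∸ x)) (m∸[m∸n]≡n (<⇒≤ a<x)))))) ,
        diag⇒row a∈diag
      diagonal (no x≰y) q∈ with a , a∈ , refl ← ∈-map⁻ _ q∈ with a∈diag , a<y ← ∈-below⁻ a∈ =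
        ((y ∸ a , y ∸ a) , inj₂ (inj₂ (m<n⇒0<n∸m a<y , refl)) , ≤-trans (m∸n≤m y a) y≤x , m∸n≤m y a ,
         sym (cong₂ _,_ (trans (∸-split (m∸n≤m y a) y≤x) (cong (_+ (x ∸ y)) (m∸[m∸n]≡n (<⇒≤ a<y)))) (m∸[m∸n]≡n (<⇒≤ a<y)))) ,
        row-sym (diag⇒row a∈diag)
        where y≤x = <⇒≤ (≰⇒> x≰y)

  ∈-Q-option-list⁺ : ∀ {p q} → Option Wythoff p q → Q q → q ∈ Q-option-list p
  ∈-Q-option-list⁺ {x , y} ((u , _) , inj₁ (0<u , refl) , u≤x , _ , refl) Q-q =
    ∈-++⁺ˡ (∈-map⁺ (_, y) (∈-below⁺ Q-q (∸-monoʳ-< 0<u u≤x)))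
  ∈-Q-option-list⁺ {x , y} ((_ , v) , inj₂ (inj₁ (refl , 0<v)) , _ , v≤y , refl) Q-q =
    ∈-++⁺ʳ (row-options (x , y)) (∈-++⁺ˡ (∈-map⁺ (x ,_) (∈-below⁺ (row-sym Q-q) (∸-monoʳ-< 0<v v≤y))))
  ∈-Q-option-list⁺ {x , y} ((u , _) , inj₂ (inj₂ (0<u , refl)) , u≤x , u≤y , refl) Q-q =
    ∈-++⁺ʳ (row-options (x , y)) (∈-++⁺ʳ (column-options (x , y)) (diagonal (x ≤? y)))
    where
      diagonal : ∀ x≤?y → (x ∸ u , y ∸ u) ∈ diagonal-options x y x≤?y
      diagonal (yes x≤y) = subst (λ t → (x ∸ u , t) ∈ diagonal-options x y (yes x≤y)) (sym y∸u≡)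
        (∈-map⁺ _ (∈-below⁺ (row⇒diag (subst (λ t → x ∸ u ∈ row t) y∸u≡ Q-q)) (∸-monoʳ-< 0<u u≤x)))
        where y∸u≡ = ∸-split u≤x x≤y
      diagonal (no x≰y) = subst (λ t → (t , y ∸ u) ∈ diagonal-options x y (no x≰y)) (sym x∸u≡)
        (∈-map⁺ _ (∈-below⁺ (row⇒diag (subst (λ t → y ∸ u ∈ row t) x∸u≡ (row-sym Q-q))) (∸-monoʳ-< 0<u u≤y)))
        where x∸u≡ = ∸-split u≤y (<⇒≤ (≰⇒> x≰y))

  Q-option-list-unique : ∀ p → Unique (Q-option-list p)
  Q-option-list-unique (x , y) =
    ++⁺ (map⁺ ,-injectiveˡ (filter⁺ _ (row-unique y)))
        (++⁺ (map⁺ ,-injectiveʳ (filter⁺ _ (row-unique x))) (diagonals-unique (x ≤? y)) columns∩diagonals≡∅)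
        rows∩rest≡∅
    where
      diagonals-unique : ∀ x≤?y → Unique (diagonal-options x y x≤?y)
      diagonals-unique (yes _) = map⁺ ,-injectiveˡ (filter⁺ _ (diag-unique (y ∸ x)))
      diagonals-unique (no _) = map⁺ ,-injectiveʳ (filter⁺ _ (diag-unique (x ∸ y)))
      in-row : ∀ {q} → q ∈ row-options (x , y) → proj₁ q < x × proj₂ q ≡ y
      in-row q∈ with r , r∈ , refl ← ∈-map⁻ _ q∈ = proj₂ (∈-below⁻ {as = row y} r∈) , refl
      in-column : ∀ {q} → q ∈ column-options (x , y) → proj₁ q ≡ x
      in-column q∈ with c , c∈ , refl ← ∈-map⁻ _ q∈ = refl
      in-diagonal : ∀ {q} x≤?y → q ∈ diagonal-options x y x≤?y → proj₁ q < x × proj₂ q < y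
      in-diagonal (yes x≤y) q∈ with a , a∈ , refl ← ∈-map⁻ (λ a → a , a + (y ∸ x)) q∈ =
        let a<x = proj₂ (∈-below⁻ {as = diag (y ∸ x)} a∈) in a<x , subst (a + (y ∸ x) <_) (m+[n∸m]≡n x≤y) (+-monoˡ-< (y ∸ x) a<x)
      in-diagonal (no x≰y) q∈ with a , a∈ , refl ← ∈-map⁻ (λ a → a + (x ∸ y) , a) q∈ =
        let a<y = proj₂ (∈-below⁻ {as = diag (x ∸ y)} a∈) in subst (a + (x ∸ y) <_) (m+[n∸m]≡n (<⇒≤ (≰⇒> x≰y))) (+-monoˡ-< (x ∸ y) a<y) , a<y
      columns∩diagonals≡∅ : Disjoint (column-options (x , y)) (diagonal-options x y (x ≤? y))
      columns∩diagonals≡∅ (q∈c , q∈d) = <-irrefl (in-column q∈c) (proj₁ (in-diagonal (x ≤? y) q∈d))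
      rows∩rest≡∅ : Disjoint (row-options (x , y)) (column-options (x , y) ++ diagonal-options x y (x ≤? y))
      rows∩rest≡∅ (q∈r , q∈rest) with ∈-++⁻ (column-options (x , y)) q∈rest
      ... | inj₁ q∈c = <-irrefl (in-column q∈c) (proj₁ (in-row q∈r))
      ... | inj₂ q∈d = <-irrefl (proj₂ (in-row q∈r)) (proj₂ (in-diagonal (x ≤? y) q∈d))

  Q-options : ∀ p → Listing (λ q → Option Wythoff p q × Q q)
  Q-options p = record
    { elements = Q-option-list p
    ; unique   = Q-option-list-unique p
    ; sound    = ∈-Q-option-list⁻
    ; complete = uncurry ∈-Q-option-list⁺
    }

  count-offset : ∀ x d → count (x , x + d) ≡ #below x (row (x + d)) + #below (x + d) (row x) + #below x (diag d)
  count-offset x d with x ≤? x + d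
  ... | yes _ = cong (λ e → #below x (row (x + d)) + #below (x + d) (row x) + #below x (diag e)) (m+n∸m≡n x d)
  ... | no x≰x+d = contradiction (m≤m+n x d) x≰x+d

  count-diagonal : ∀ x → count (x , x) ≡ #below x (row x) + #below x (row x) + #below x (diag 0)
  count-diagonal x with x ≤? x
  ... | yes _ = cong (λ e → #below x (row x) + #below x (row x) + #below x (diag e)) (n∸n≡0 x)
  ... | no x≰x = contradiction ≤-refl x≰x

  count-sym : ∀ x y → count (x , y) ≡ count (y , x)
  count-sym x y = cong₂ _+_ (+-comm (#below x (row y)) _) (diagonal-count-sym (x ≤? y) (y ≤? x))
    where
      diagonal-count-sym : ∀ x≤?y y≤?x → diagonal-count x y x≤?y ≡ diagonal-count y x y≤?x
      diagonal-count-sym (yes x≤y) (yes y≤x) with refl ← ≤-antisym x≤y y≤x = refl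
      diagonal-count-sym (yes _) (no _) = refl
      diagonal-count-sym (no _) (yes _) = refl
      diagonal-count-sym (no x≰y) (no y≰x) = contradiction (<⇒≤ (≰⇒> y≰x)) x≰y

  CountFits : ℕ → Pos → Set
  CountFits b p = (Q p → count p ≤ b) × (¬ Q p → b < count p)

  Q-fits : ∀ {b p} → Q p → count p ≤ b → CountFits b p
  Q-fits Q-p few = (λ _ → few) , contradiction Q-p

  ¬Q-fits : ∀ {b p} → ¬ Q p → b < count p → CountFits b p
  ¬Q-fits ¬Q-p many = (λ Q-p → contradiction Q-p ¬Q-p) , (λ _ → many)

  module Blocking (b : ℕ) (fits-offset : ∀ x d → CountFits b (x , x + d)) where

    fits : ∀ p → CountFits b p
    fits (x , y) with ≤-total x y
    ... | inj₁ x≤y = subst (λ y → CountFits b (x , y)) (m+[n∸m]≡n x≤y) (fits-offset x (y ∸ x))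
    ... | inj₂ y≤x =
      let few , many = subst (λ x → CountFits b (y , x)) (m+[n∸m]≡n y≤x) (fits-offset y (x ∸ y))
      in  subst (_≤ b) (count-sym y x) ∘ few ∘ row-sym , subst (b <_) (count-sym y x) ∘ many ∘ (_∘ row-sym)

    P-positions : ∀ p → Characterises Wythoff (suc b) Q p
    P-positions = characterised-by-counting wythoff-nonnull Q-options
      (λ p → subst (_≤ b) (sym (length-Q-option-list p)) ∘ proj₁ (fits p))
      (λ p → subst (b <_) (sym (length-Q-option-list p)) ∘ proj₂ (fits p))

    not-redundant : ∀ {x y u v} → Wythoff (u , v) → u ≤ x → v ≤ y → count (x , y) ≡ suc b → Q (x ∸ u , y ∸ v) →
                    PSetsDiffer Wythoff (remove Wythoff (u , v)) (suc b)
    not-redundant {x} {y} w u≤x v≤y count≡1+b Q-target =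
      removal-changes-P-positions wythoff? wythoff-nonnull w u≤x v≤y (proj₁ (P-positions _) Q-target)
        P-options (trans (length-Q-option-list (x , y)) count≡1+b)
      where
        P-options : Listing (λ q → Option Wythoff (x , y) q × PrevWins Wythoff (suc b) q)
        P-options = record
          { elements = Q-option-list (x , y)
          ; unique   = Q-option-list-unique (x , y)
          ; sound    = map₂ (proj₁ (P-positions _)) ∘ ∈-Q-option-list⁻
          ; complete = λ { {q} (q-option , prev-q) → ∈-Q-option-list⁺ q-option (characterisation⇒sound {Q = Q} (Q? q) (P-positions q) prev-q) }
          }

module W³ where

  row : ℕ → List ℕ
  row zero = 0 ∷ 1 ∷ 2 ∷ []
  row (suc y) = ⌊ y /2⌋ ∷ suc (double (suc y)) ∷ suc (suc (double (suc y))) ∷ []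

  diag : ℕ → List ℕ
  diag zero = 0 ∷ []
  diag (suc zero) = 0 ∷ []
  diag (suc (suc e)) = e ∷ suc e ∷ []

  1+double∈row : ∀ n → suc (double n) ∈ row n
  1+double∈row zero = there (here refl)
  1+double∈row (suc n) = there (here refl)

  2+double∈row : ∀ n → suc (suc (double n)) ∈ row n
  2+double∈row zero = there (there (here refl))
  2+double∈row (suc n) = there (there (here refl))

  row-sym : ∀ {x y} → x ∈ row y → y ∈ row x
  row-sym {y = zero} (here refl) = here refl
  row-sym {y = zero} (there (here refl)) = here refl
  row-sym {y = zero} (there (there (here refl))) = here refl
  row-sym {y = suc y} (here refl) with parity y
  ... | even n = subst (λ x → suc (double n) ∈ row x) (sym (⌊double/2⌋ n)) (1+double∈row n)
  ... | odd n = subst (λ x → suc (suc (double n)) ∈ row x) (sym (⌊1+double/2⌋ n)) (2+double∈row n)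
  row-sym {y = suc y} (there (here refl)) = here (sym (⌊double/2⌋ (suc y)))
  row-sym {y = suc y} (there (there (here refl))) = here (sym (⌊1+double/2⌋ (suc y)))

  diag⇒row : ∀ {a d} → a ∈ diag d → a ∈ row (a + d)
  diag⇒row {d = zero} (here refl) = here refl
  diag⇒row {d = suc zero} (here refl) = here refl
  diag⇒row {d = suc (suc e)} (here refl) rewrite +-suc e (suc e) | +-suc e e = here (sym (⌊1+double/2⌋ e))
  diag⇒row {d = suc (suc e)} (there (here refl)) rewrite +-suc e (suc e) | +-suc e e = here (sym (cong suc (⌊double/2⌋ e)))

  ∈diag-suc : ∀ a → a ∈ diag (suc a)
  ∈diag-suc zero = here refl
  ∈diag-suc (suc a) = there (here refl)

  row⇒diag : ∀ {a d} → a ∈ row (a + d) → a ∈ diag d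
  row⇒diag {a} {d} a∈ with a + d in a+d≡ | a∈
  ... | zero | _ with refl ← m+n≡0⇒m≡0 a a+d≡ | refl ← m+n≡0⇒n≡0 a a+d≡ = here refl
  ... | suc z | there (here refl) = contradiction (subst (a ≤_) a+d≡ (m≤m+n a d)) (<⇒≱ (s≤s (m≤m+n (suc z) (suc z))))
  ... | suc z | there (there (here refl)) = contradiction (subst (a ≤_) a+d≡ (m≤m+n a d)) (<⇒≱ (s≤s (≤-trans (m≤m+n (suc z) (suc z)) (n≤1+n _))))
  ... | suc z | here refl with parity z
  ...   | even n rewrite ⌊double/2⌋ n | +-cancelˡ-≡ n d (suc n) (trans a+d≡ (sym (+-suc n n))) = ∈diag-suc n
  ...   | odd n rewrite ⌊1+double/2⌋ n | +-cancelˡ-≡ n d (suc (suc n)) (trans a+d≡ (sym (trans (+-suc n (suc n)) (cong suc (+-suc n n))))) = here refl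

  row-unique : ∀ y → Unique (row y)
  row-unique zero = ((λ ()) ∷ (λ ()) ∷ []) ∷ ((λ ()) ∷ []) ∷ [] ∷ []
  row-unique (suc y) = (<⇒≢ half<big ∷ <⇒≢ (m≤n⇒m≤1+n half<big) ∷ []) ∷ (<⇒≢ ≤-refl ∷ []) ∷ [] ∷ []
    where
      half<big : ⌊ y /2⌋ < suc (double (suc y))
      half<big = s≤s (≤-trans (⌊n/2⌋≤n y) (≤-trans (n≤1+n y) (m≤m+n (suc y) (suc y))))

  diag-unique : ∀ d → Unique (diag d)
  diag-unique zero = [] ∷ []
  diag-unique (suc zero) = [] ∷ []
  diag-unique (suc (suc e)) = (<⇒≢ ≤-refl ∷ []) ∷ [] ∷ []

  open RowDiagonalSet row diag row-sym diag⇒row row⇒diag row-unique diag-unique public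

  diag-head-below : ∀ {x d} → d ≤ suc x → 1 ≤ #below (suc x) (diag d)
  diag-head-below {d = zero} _ = s≤s z≤n
  diag-head-below {d = suc zero} _ = s≤s z≤n
  diag-head-below {d = suc (suc e)} d≤ = #below-head (suc e ∷ []) (≤-trans (n≤1+n (suc e)) d≤)

  ∉short-diag : ∀ {x d} → d ≤ suc x → suc x ∉ diag d
  ∉short-diag {d = zero} _ (here ())
  ∉short-diag {d = suc zero} _ (here ())
  ∉short-diag {d = suc (suc e)} d≤ (here refl) = 1+n≰n (≤-trans (s≤s (n≤1+n _)) d≤)
  ∉short-diag {d = suc (suc e)} d≤ (there (here refl)) = 1+n≰n d≤

  fits-near : ∀ x d → d ≤ suc x → CountFits 2 (suc x , suc x + d)
  fits-near x d d≤ = ¬Q-fits {p = suc x , suc x + d} (∉short-diag d≤ ∘ row⇒diag)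
    (subst (2 <_) (sym (count-offset (suc x) d)) (+-mono-≤ (+-mono-≤ row-hit column-hit) (diag-head-below d≤)))
    where
      row-hit : 1 ≤ #below (suc x) (row (suc x + d))
      row-hit = #below-head {x = suc x} (suc (double (suc (x + d))) ∷ suc (suc (double (suc (x + d)))) ∷ [])
        (s≤s (≤-trans (⌊n/2⌋-mono (+-monoʳ-≤ x d≤)) (≤-reflexive (trans (cong ⌊_/2⌋ (+-suc x x)) (⌊1+double/2⌋ x)))))
      column-hit : 1 ≤ #below (suc x + d) (row (suc x))
      column-hit = #below-head {x = suc x + d} (suc (double (suc x)) ∷ suc (suc (double (suc x))) ∷ []) (≤-trans (s≤s (⌊n/2⌋≤n x)) (m≤m+n (suc x) d))

  #below-row : ∀ x y → x ≤ suc y → #below x (row (suc y)) ≤ 𝟙[ ⌊ y /2⌋ < x ]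
  #below-row x y x≤ = subst (#below x (row (suc y)) ≤_) (+-identityʳ _) $ +-monoʳ-≤ 𝟙[ ⌊ y /2⌋ < x ] (+-mono-≤ (𝟙[<]≤0 x≤2y+3) (+-mono-≤ (𝟙[<]≤0 (≤-trans x≤2y+3 (n≤1+n _))) z≤n))
    where
      x≤2y+3 : x ≤ suc (double (suc y))
      x≤2y+3 = ≤-trans x≤ (≤-trans (m≤m+n (suc y) (suc y)) (n≤1+n _))

  fits-far : ∀ x t → CountFits 2 (suc x , suc x + (t + suc (suc x)))
  fits-far x zero = Q-fits {p = suc x , suc x + suc (suc x)} (diag⇒row (there (here refl)))
    (subst (_≤ 2) (sym (count-offset (suc x) (suc (suc x)))) (+-mono-≤ (+-mono-≤ row-part column-part) diag-part))
    where
      Y = suc x + suc (suc x)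
      half≡ : ⌊ x + suc (suc x) /2⌋ ≡ suc x
      half≡ = trans (cong ⌊_/2⌋ (+-suc x (suc x))) (trans (cong (⌊_/2⌋ ∘ suc) (+-suc x x)) (cong suc (⌊double/2⌋ x)))
      row-part : #below (suc x) (row Y) ≤ 0
      row-part = ≤-trans (#below-row (suc x) (x + suc (suc x)) (s≤s (m≤m+n x _))) (𝟙[<]≤0 (≤-reflexive (sym half≡)))
      column-part : #below Y (row (suc x)) ≤ 1
      column-part = +-mono-≤ (𝟙[<]≤1 ⌊ x /2⌋ Y) (+-mono-≤ (𝟙[<]≤0 (≤-reflexive Y≡)) (+-mono-≤ (𝟙[<]≤0 (≤-trans (≤-reflexive Y≡) (n≤1+n _))) z≤n))
        where Y≡ : Y ≡ suc (double (suc x))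
              Y≡ = cong suc (+-suc x (suc x))
      diag-part : #below (suc x) (diag (suc (suc x))) ≤ 1
      diag-part = +-mono-≤ (𝟙[<]≤1 x (suc x)) (+-mono-≤ (𝟙[<]≤0 {suc x} {suc x} ≤-refl) z≤n)
  fits-far x (suc zero) = Q-fits {p = suc x , suc x + suc (suc (suc x))} (diag⇒row (here refl))
    (subst (_≤ 2) (sym (count-offset (suc x) (suc (suc (suc x))))) (+-mono-≤ (+-mono-≤ row-part column-part) diag-part))
    where
      Y = suc x + suc (suc (suc x))
      half≡ : ⌊ x + suc (suc (suc x)) /2⌋ ≡ suc x
      half≡ = trans (cong ⌊_/2⌋ (trans (+-suc x (suc (suc x))) (cong suc (trans (+-suc x (suc x)) (cong suc (+-suc x x))))))
                    (cong suc (⌊1+double/2⌋ x))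
      row-part : #below (suc x) (row Y) ≤ 0
      row-part = ≤-trans (#below-row (suc x) (x + suc (suc (suc x))) (s≤s (m≤m+n x _))) (𝟙[<]≤0 (≤-reflexive (sym half≡)))
      column-part : #below Y (row (suc x)) ≤ 2
      column-part = +-mono-≤ (𝟙[<]≤1 ⌊ x /2⌋ Y) (+-mono-≤ (𝟙[<]≤1 (suc (double (suc x))) Y) (+-mono-≤ (𝟙[<]≤0 (≤-reflexive Y≡)) z≤n))
        where Y≡ : Y ≡ suc (suc (double (suc x)))
              Y≡ = cong suc (trans (+-suc x (suc (suc x))) (cong suc (+-suc x (suc x))))
      diag-part : #below (suc x) (diag (suc (suc (suc x)))) ≤ 0
      diag-part = +-mono-≤ (𝟙[<]≤0 {suc x} {suc x} ≤-refl) (+-mono-≤ (𝟙[<]≤0 {suc (suc x)} {suc x} (n≤1+n _)) z≤n)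
  fits-far x (suc (suc t)) = ¬Q-fits {p = suc x , suc x + d} (∉long-diag ∘ row⇒diag)
    (subst (2 <_) (sym (count-offset (suc x) d)) (≤-trans (≤-trans column-part (m≤n+m _ (#below (suc x) (row (suc x + d))))) (m≤m+n _ (#below (suc x) (diag d)))))
    where
      d = suc (suc (t + suc (suc x)))
      ∉long-diag : suc x ∉ diag d
      ∉long-diag (here eq) = <⇒≢ (m≤n+m (suc (suc x)) t) eq
      ∉long-diag (there (here eq)) = <⇒≢ (s≤s (≤-trans (n≤1+n (suc x)) (m≤n+m (suc (suc x)) t))) eq
      top = suc (suc (double (suc x)))
      top<Y : top < suc x + d
      top<Y = subst (top <_) (sym (Y≡ x t)) (m≤m+n (suc top) t)
        where Y≡ : ∀ x t → suc x + suc (suc (t + suc (suc x))) ≡ suc (suc (suc (suc x + suc x))) + t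
              Y≡ = solve-∀
      column-part : 3 ≤ #below (suc x + d) (row (suc x))
      column-part = +-mono-≤ (𝟙[<]≥1 (≤-<-trans ⌊x/2⌋≤top top<Y))
                   (+-mono-≤ (𝟙[<]≥1 (≤-<-trans (n≤1+n _) top<Y)) (+-mono-≤ (𝟙[<]≥1 top<Y) z≤n))
        where ⌊x/2⌋≤top : ⌊ x /2⌋ ≤ top
              ⌊x/2⌋≤top = ≤-trans (⌊n/2⌋≤n x) (m≤n⇒m≤1+n (m≤n⇒m≤1+n (m≤n⇒m≤1+n (m≤m+n x (suc x)))))

  count-fits : ∀ x d → CountFits 2 (x , x + d)
  count-fits zero zero = Q-fits {p = 0 , 0} (here refl) z≤n
  count-fits zero (suc zero) = Q-fits {p = 0 , 1} (here refl) (s≤s z≤n)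
  count-fits zero (suc (suc zero)) = Q-fits {p = 0 , 2} (here refl) ≤-refl
  count-fits zero (suc (suc (suc t))) =
    ¬Q-fits {p = 0 , suc (suc (suc t))} (λ { (here ()) ; (there (here ())) ; (there (there (here ()))) }) ≤-refl
  count-fits (suc x) d with ≤-<-connex d (suc x)
  ... | inj₁ d≤ = fits-near x d d≤
  ... | inj₂ x<d = subst (λ d → CountFits 2 (suc x , suc x + d)) (m∸n+n≡m x<d) (fits-far x (d ∸ suc (suc x)))

  open Blocking 2 count-fits

  #below-own-row : ∀ u → #below (suc u) (row (suc u)) ≡ 1
  #below-own-row u
    rewrite 𝟙[<]≡1 {⌊ u /2⌋} {suc u} (s≤s (⌊n/2⌋≤n u))
          | 𝟙[<]≡0 {suc (double (suc u))} {suc u} (≤-trans (m≤m+n (suc u) (suc u)) (n≤1+n _))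
          | 𝟙[<]≡0 {suc (suc (double (suc u)))} {suc u} (≤-trans (m≤m+n (suc u) (suc u)) (≤-trans (n≤1+n _) (n≤1+n _))) = refl

  no-redundant-move : ∀ m → Wythoff m → PSetsDiffer Wythoff (remove Wythoff m) 3
  no-redundant-move (suc u , _) w@(inj₁ (_ , refl)) =
    not-redundant {y = 0} w (≤-trans (n≤1+n _) (n≤1+n _)) z≤n refl
      (subst (λ x → Q (x , 0)) (sym (m+n∸n≡m 2 u)) (there (there (here refl))))
  no-redundant-move (_ , suc v) w@(inj₂ (inj₁ (refl , _))) =
    not-redundant {x = 0} w z≤n (≤-trans (n≤1+n _) (n≤1+n _)) refl
      (subst (λ y → Q (0 , y)) (sym (m+n∸n≡m 2 v)) (here refl))
  no-redundant-move (suc u , _) w@(inj₂ (inj₂ (_ , refl))) =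
    not-redundant w ≤-refl ≤-refl count≡3 (subst (λ x → Q (x , x)) (sym (n∸n≡0 u)) (here refl))
    where
      count≡3 : count (suc u , suc u) ≡ 3
      count≡3 = trans (count-diagonal (suc u)) (cong₂ (λ r r′ → r + r′ + 1) (#below-own-row u) (#below-own-row u))

module WythoffPairs where

  open import Data.List.Membership.DecPropositional _≟_ using (_∈?_)

  mex-search : List ℕ → ℕ → ℕ → ℕ
  mex-search L zero n = n
  mex-search L (suc fuel) n with n ∈? L
  ... | yes _ = mex-search L fuel (suc n)
  ... | no _ = n

  mex-search-spec : ∀ L fuel n → (∀ {m} → m < n → m ∈ L) → max 0 L < n + fuel →
                    (∀ {m} → m < mex-search L fuel n → m ∈ L) × mex-search L fuel n ∉ L
  mex-search-spec L zero n below bound =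
    below , λ n∈L → <⇒≱ (subst (max 0 L <_) (+-identityʳ n) bound) (lookup (xs≤max 0 L) n∈L)
  mex-search-spec L (suc fuel) n below bound with n ∈? L
  ... | no n∉L = below , n∉L
  ... | yes n∈L = mex-search-spec L fuel (suc n) below′ (subst (max 0 L <_) (+-suc n fuel) bound)
    where
      below′ : ∀ {m} → m < suc n → m ∈ L
      below′ {m} m<1+n with m ≟ n
      ... | yes refl = n∈L
      ... | no m≢n = below (≤∧≢⇒< (≤-pred m<1+n) m≢n)

  opaque
    mex : List ℕ → ℕ
    mex L = mex-search L (suc (max 0 L)) 0

    mex-spec : ∀ L → (∀ {m} → m < mex L → m ∈ L) × mex L ∉ L
    mex-spec L = mex-search-spec L (suc (max 0 L)) 0 (λ ()) ≤-refl

  mex-least : ∀ L {m} → m < mex L → m ∈ L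
  mex-least L = proj₁ (mex-spec L)

  mex-∉ : ∀ L → mex L ∉ L
  mex-∉ L = proj₂ (mex-spec L)

  -- (A m, B m) is the m-th P-position of Wythoff's game.
  mutual
    A : ℕ → ℕ
    A m = mex (taken m)

    taken : ℕ → List ℕ
    taken zero = []
    taken (suc m) = A m ∷ A m + m ∷ taken m

  B : ℕ → ℕ
  B m = A m + m

  opaque
    unfolding mex

    A-0 : A 0 ≡ 0
    A-0 = refl

    A-1 : A 1 ≡ 1
    A-1 = refl

    A-3 : A 3 ≡ 4
    A-3 = refl

  B-0 : B 0 ≡ 0
  B-0 = trans (+-identityʳ (A 0)) A-0

  ∈taken⇒A∨B : ∀ {n m} → n ∈ taken m → ∃[ j ] j < m × (n ≡ A j ⊎ n ≡ B j)
  ∈taken⇒A∨B {m = suc m} (here n≡) = m , ≤-refl , inj₁ n≡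
  ∈taken⇒A∨B {m = suc m} (there (here n≡)) = m , ≤-refl , inj₂ n≡
  ∈taken⇒A∨B {m = suc m} (there (there n∈)) = let j , j<m , n≡ = ∈taken⇒A∨B n∈ in j , m≤n⇒m≤1+n j<m , n≡

  B∈taken : ∀ {j m} → j < m → B j ∈ taken m
  B∈taken {j} {suc m} j<1+m with j ≟ m
  ... | yes refl = there (here refl)
  ... | no j≢m = there (there (B∈taken (≤∧≢⇒< (≤-pred j<1+m) j≢m)))

  A-<-suc : ∀ m → A m < A (suc m)
  A-<-suc m with <-cmp (A m) (A (suc m))
  ... | tri< A<A′ _ _ = A<A′
  ... | tri≈ _ A≡A′ _ = contradiction (subst (_∈ taken (suc m)) A≡A′ (here refl)) (mex-∉ (taken (suc m)))
  ... | tri> _ _ A′<A = contradiction (there (there (mex-least (taken m) A′<A))) (mex-∉ (taken (suc m)))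

  A-strictMono : ∀ {j m} → j < m → A j < A m
  A-strictMono {j} {suc m} j<1+m with j ≟ m
  ... | yes refl = A-<-suc j
  ... | no j≢m = <-trans (A-strictMono (≤∧≢⇒< (≤-pred j<1+m) j≢m)) (A-<-suc m)

  A-mono : ∀ {j m} → j ≤ m → A j ≤ A m
  A-mono {j} {m} j≤m with j ≟ m
  ... | yes refl = ≤-refl
  ... | no j≢m = <⇒≤ (A-strictMono (≤∧≢⇒< j≤m j≢m))

  n≤A : ∀ m → m ≤ A m
  n≤A zero = z≤n
  n≤A (suc m) = ≤-trans (s≤s (n≤A m)) (A-<-suc m)

  A-injective : ∀ {j l} → A j ≡ A l → j ≡ l
  A-injective {j} {l} A≡ with <-cmp j l
  ... | tri< j<l _ _ = contradiction A≡ (<⇒≢ (A-strictMono j<l))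
  ... | tri≈ _ j≡l _ = j≡l
  ... | tri> _ _ l<j = contradiction (sym A≡) (<⇒≢ (A-strictMono l<j))

  B-strictMono : ∀ {j m} → j < m → B j < B m
  B-strictMono j<m = +-mono-< (A-strictMono j<m) j<m

  B-mono : ∀ {j m} → j ≤ m → B j ≤ B m
  B-mono j≤m = +-mono-≤ (A-mono j≤m) j≤m

  B-injective : ∀ {j l} → B j ≡ B l → j ≡ l
  B-injective {j} {l} B≡ with <-cmp j l
  ... | tri< j<l _ _ = contradiction B≡ (<⇒≢ (B-strictMono j<l))
  ... | tri≈ _ j≡l _ = j≡l
  ... | tri> _ _ l<j = contradiction (sym B≡) (<⇒≢ (B-strictMono l<j))

  B-cancel-< : ∀ {j l} → B j < B l → j < l
  B-cancel-< {j} {l} B<B with suc j ≤? l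
  ... | yes j<l = j<l
  ... | no j≮l = contradiction (B-mono (≮⇒≥ j≮l)) (<⇒≱ B<B)

  B-gap : ∀ j → 2 + B j ≤ B (suc j)
  B-gap j = subst (2 + B j ≤_) (sym (+-suc (A (suc j)) j)) (s≤s (+-monoˡ-≤ j (A-<-suc j)))

  A≡B⇒zero : ∀ {j l} → A j ≡ B l → j ≡ 0 × l ≡ 0
  A≡B⇒zero {j} {l} A≡B with <-cmp l j
  ... | tri< l<j _ _ = contradiction (subst (_∈ taken j) (sym A≡B) (B∈taken l<j)) (mex-∉ (taken j))
  ... | tri≈ _ refl _ = let j≡0 = sym (+-cancelˡ-≡ (A j) 0 j (trans (+-identityʳ (A j)) A≡B)) in j≡0 , j≡0
  ... | tri> _ _ j<l = contradiction A≡B (<⇒≢ (<-≤-trans (A-strictMono j<l) (m≤m+n (A l) l)))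

  A-or-B : ∀ n → ∃[ j ] (n ≡ A j ⊎ n ≡ B j)
  A-or-B n = let j , _ , n≡ = ∈taken⇒A∨B (mex-least (taken (suc n)) (n≤A (suc n))) in j , n≡

  WythoffPair : ℕ → ℕ → Set
  WythoffPair a b = ∃[ j ] ((a ≡ A j × b ≡ B j) ⊎ (a ≡ B j × b ≡ A j))

  pair-sym : ∀ {a b} → WythoffPair a b → WythoffPair b a
  pair-sym (j , inj₁ (a≡ , b≡)) = j , inj₂ (b≡ , a≡)
  pair-sym (j , inj₂ (a≡ , b≡)) = j , inj₁ (b≡ , a≡)

  pair-unique : ∀ {a b b′} → WythoffPair a b → WythoffPair a b′ → b ≡ b′
  pair-unique (j , inj₁ (a≡ , b≡)) (l , inj₁ (a≡′ , b≡′)) with refl ← A-injective (trans (sym a≡) a≡′) = trans b≡ (sym b≡′)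
  pair-unique (j , inj₁ (a≡ , b≡)) (l , inj₂ (a≡′ , b≡′)) with refl , refl ← A≡B⇒zero (trans (sym a≡) a≡′) =
    trans b≡ (trans (+-identityʳ (A 0)) (sym b≡′))
  pair-unique (j , inj₂ (a≡ , b≡)) (l , inj₁ (a≡′ , b≡′)) with refl , refl ← A≡B⇒zero (trans (sym a≡′) a≡) =
    trans b≡ (trans (sym (+-identityʳ (A 0))) (sym b≡′))
  pair-unique (j , inj₂ (a≡ , b≡)) (l , inj₂ (a≡′ , b≡′)) with refl ← B-injective (trans (sym a≡) a≡′) = trans b≡ (sym b≡′)

  opaque
    partner : ℕ → ℕ
    partner n with A-or-B n
    ... | j , inj₁ _ = B j
    ... | j , inj₂ _ = A j

    pair-partner : ∀ n → WythoffPair n (partner n)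
    pair-partner n with A-or-B n
    ... | j , inj₁ n≡ = j , inj₁ (n≡ , refl)
    ... | j , inj₂ n≡ = j , inj₂ (n≡ , refl)

  partner-unique : ∀ {a b} → WythoffPair a b → partner a ≡ b
  partner-unique = pair-unique (pair-partner _)

  partner-involutive : ∀ a → partner (partner a) ≡ a
  partner-involutive a = partner-unique (pair-sym (pair-partner a))

  partner-0 : partner 0 ≡ 0
  partner-0 = partner-unique (0 , inj₁ (sym A-0 , sym B-0))

  partner-B : ∀ m → partner (B m) ≡ A m
  partner-B m = partner-unique (m , inj₂ (refl , refl))

  partner≤double : ∀ a → partner a ≤ a + a
  partner≤double a with pair-partner a
  ... | j , inj₁ (refl , b≡) = ≤-trans (≤-reflexive b≡) (+-monoʳ-≤ (A j) (n≤A j))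
  ... | j , inj₂ (refl , b≡) = ≤-trans (≤-reflexive b≡) (≤-trans (m≤m+n (A j) j) (m≤m+n (B j) (B j)))

  pair-offset⇒A : ∀ {a m} → WythoffPair a (a + m) → a ≡ A m
  pair-offset⇒A {a} {m} (j , inj₁ (refl , a+m≡)) = cong A (sym (+-cancelˡ-≡ (A j) m j a+m≡))
  pair-offset⇒A {a} {m} (j , inj₂ (refl , a+m≡)) = trans (cong B j≡0) (trans B-0 (trans (sym A-0) (cong A (sym m≡0))))
    where
      j+m≡0 : j + m ≡ 0
      j+m≡0 = +-cancelˡ-≡ (A j) (j + m) 0 (trans (sym (+-assoc (A j) j m)) (trans a+m≡ (sym (+-identityʳ (A j)))))
      j≡0 = m+n≡0⇒m≡0 j j+m≡0
      m≡0 = m+n≡0⇒n≡0 j j+m≡0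

  partner-offset : ∀ a m → 1 ≤ m → a + m ≤ partner a → a ≤ A m → partner a ≡ a + m
  partner-offset a m 1≤m a+m≤ a≤Am with pair-partner a
  ... | j , inj₂ (refl , b≡) = contradiction (subst (a + m ≤_) b≡ a+m≤) (<⇒≱ (≤-<-trans (m≤m+n (A j) j) (m<m+n (B j) 1≤m)))
  ... | j , inj₁ (refl , b≡) with <-cmp j m
  ...   | tri≈ _ refl _ = b≡
  ...   | tri> _ _ m<j = contradiction a≤Am (<⇒≱ (A-strictMono m<j))
  ...   | tri< j<m _ _ = contradiction (subst (A j + m ≤_) b≡ a+m≤) (<⇒≱ (+-monoʳ-< (A j) j<m))

  B-no-successor : ∀ j l → B l ≢ suc (B j)
  B-no-successor j l B≡ = 1+n≰n (≤-trans (B-gap j) (≤-trans (B-mono j<l) (≤-reflexive B≡)))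
    where j<l = B-cancel-< (subst (B j <_) (sym B≡) ≤-refl)

  A≢B : ∀ {x y} → 1 ≤ x → A x ≢ B y
  A≢B 1≤x A≡B = <⇒≢ 1≤x (sym (proj₁ (A≡B⇒zero A≡B)))

  ∉taken⇒A≤ : ∀ {n m} → n ∉ taken m → A m ≤ n
  ∉taken⇒A≤ {n} {m} n∉ with A m ≤? n
  ... | yes A≤n = A≤n
  ... | no A≰n = contradiction (mex-least (taken m) (≰⇒> A≰n)) n∉

  A-suc≤2+A : ∀ l → A (suc l) ≤ 2 + A l
  A-suc≤2+A l with suc (A l) ∈? taken (suc l)
  ... | no ∉ = ≤-trans (∉taken⇒A≤ ∉) (n≤1+n _)
  ... | yes ∈ with ∈taken⇒A∨B ∈
  ...   | p , p<1+l , inj₁ A≡ = contradiction (subst (_≤ A l) (sym A≡) (A-mono (≤-pred p<1+l))) 1+n≰n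
  ...   | p , _ , inj₂ B≡ with suc (suc (A l)) ∈? taken (suc l)
  ...     | no ∉ = ∉taken⇒A≤ ∉
  ...     | yes ∈′ with ∈taken⇒A∨B ∈′
  ...       | q , q<1+l , inj₁ A≡ = contradiction (subst (_≤ A l) (sym A≡) (A-mono (≤-pred q<1+l))) (λ 2+A≤A → 1+n≰n (≤-trans (n≤1+n _) 2+A≤A))
  ...       | q , _ , inj₂ B≡′ = contradiction (trans (sym B≡′) (cong suc B≡)) (B-no-successor p q)

  B-bracket : ∀ u n l → B l < u → u ≤ B (n + l) → ∃[ l′ ] B l′ < u × u ≤ B (suc l′)
  B-bracket u zero l B<u u≤B = contradiction u≤B (<⇒≱ B<u)
  B-bracket u (suc n) l B<u u≤B with u ≤? B (suc l)
  ... | yes u≤B′ = l , B<u , u≤B′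
  ... | no u≰B′ = B-bracket u n (suc l) (≰⇒> u≰B′) (subst (λ k → u ≤ B k) (sym (+-suc n l)) u≤B)

  A-pos : ∀ {j} → 1 ≤ j → 1 ≤ A j
  A-pos {suc j} _ = ≤-trans (s≤s z≤n) (n≤A (suc j))

  -- The first B-number ≥ A j is at most 3 above the previous one, which is < A j, so it
  -- would be one of A j, A j + 1, A j + 2.
  no-three-consecutive-A : ∀ j → 1 ≤ j → A (suc j) ≡ suc (A j) → A (suc (suc j)) ≡ suc (suc (A j)) → ⊥
  no-three-consecutive-A j 1≤j A′≡ A″≡ with B-bracket (A j) (A j) 0 (subst (_< A j) (sym B-0) (A-pos 1≤j))
                                                    (subst (λ k → A j ≤ B k) (sym (+-identityʳ (A j))) (m≤n+m (A j) (A (A j))))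
  ... | l , B<u , u≤B′ = <-irrefl refl (<-≤-trans B′<u+3 u+3≤B′)
    where
      u = A j
      u+3≤B′ : 3 + u ≤ B (suc l)
      u+3≤B′ = ≤∧≢⇒< (≤∧≢⇒< (≤∧≢⇒< u≤B′ (A≢B 1≤j)) (A≢B {suc j} (s≤s z≤n) ∘ trans A′≡)) (A≢B {suc (suc j)} (s≤s z≤n) ∘ trans A″≡)
      B′<u+3 : B (suc l) < 3 + u
      B′<u+3 = ≤-<-trans (≤-trans (+-monoˡ-≤ (suc l) (A-suc≤2+A l)) (≤-reflexive (cong (suc ∘ suc) (+-suc (A l) l))))
                         (s≤s (s≤s (s≤s B<u)))

  B-step-2 : ∀ {j l} → B l ≡ 2 + B j → l ≡ suc j × A (suc j) ≡ suc (A j)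
  B-step-2 {j} {l} B≡ with l ≟ suc j
  ... | yes refl = refl , +-cancelʳ-≡ j (A (suc j)) (suc (A j)) (suc-injective (trans (sym (+-suc (A (suc j)) j)) B≡))
  ... | no l≢1+j = contradiction (B-mono (≤∧≢⇒< j<l (l≢1+j ∘ sym))) (<⇒≱ B<B″)
    where
      j<l : j < l
      j<l = B-cancel-< (subst (B j <_) (sym B≡) (n≤1+n _))
      B<B″ : B l < B (suc (suc j))
      B<B″ = subst (_< B (suc (suc j))) (sym B≡) (≤-trans (s≤s (s≤s (s≤s (n≤1+n _)))) (≤-trans (s≤s (s≤s (B-gap j))) (B-gap (suc j))))

  -- Holds exactly for c = A j with j ≥ 1.
  Lower : ℕ → Set
  Lower c = c < partner c

  A⇒lower : ∀ {c j} → 1 ≤ j → c ≡ A j → Lower c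
  A⇒lower {c} {j} 1≤j c≡ = subst (c <_) (sym (partner-unique (j , inj₁ (c≡ , refl)))) (subst (_< B j) (sym c≡) (m<m+n (A j) 1≤j))

  lower-or-B : ∀ c → 1 ≤ c → Lower c ⊎ ∃[ j ] (1 ≤ j × c ≡ B j)
  lower-or-B c 1≤c with pair-partner c
  ... | zero , inj₁ (c≡ , _) = contradiction (trans c≡ A-0) (<⇒≢ 1≤c ∘ sym)
  ... | suc j , inj₁ (c≡ , _) = inj₁ (A⇒lower (s≤s z≤n) c≡)
  ... | zero , inj₂ (c≡ , _) = contradiction (trans c≡ B-0) (<⇒≢ 1≤c ∘ sym)
  ... | suc j , inj₂ (c≡ , _) = inj₂ (suc j , s≤s z≤n , c≡)

  consecutive-lower : ∀ c → Lower c ⊎ Lower (suc c)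
  consecutive-lower zero = inj₂ (A⇒lower (s≤s z≤n) (sym A-1))
  consecutive-lower (suc c) with lower-or-B (suc c) (s≤s z≤n) | lower-or-B (suc (suc c)) (s≤s z≤n)
  ... | inj₁ lower | _ = inj₁ lower
  ... | inj₂ _ | inj₁ lower = inj₂ lower
  ... | inj₂ (j , _ , c≡) | inj₂ (l , _ , c′≡) = contradiction (trans (sym c′≡) (cong suc c≡)) (B-no-successor j l)

  lower-every-other : ∀ t → Lower t ⊎ Lower (2 + t) ⊎ Lower (4 + t)
  lower-every-other zero = inj₂ (inj₂ (A⇒lower {j = 3} (s≤s z≤n) (sym A-3)))
  lower-every-other (suc t) with lower-or-B (suc t) (s≤s z≤n) | lower-or-B (3 + t) (s≤s z≤n) | lower-or-B (5 + t) (s≤s z≤n)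
  ... | inj₁ lower | _ | _ = inj₁ lower
  ... | inj₂ _ | inj₁ lower | _ = inj₂ (inj₁ lower)
  ... | inj₂ _ | inj₂ _ | inj₁ lower = inj₂ (inj₂ lower)
  ... | inj₂ (j , 1≤j , t≡) | inj₂ (l , _ , t′≡) | inj₂ (r , _ , t″≡)
    with refl , A′≡ ← B-step-2 {j} {l} (trans (sym t′≡) (cong (suc ∘ suc) t≡))
    with refl , A″≡ ← B-step-2 {suc j} {r} (trans (sym t″≡) (cong (suc ∘ suc) t′≡)) =
      ⊥-elim (no-three-consecutive-A j 1≤j A′≡ (trans A″≡ (cong suc A′≡)))

module W² where

  open WythoffPairs

  companion : ℕ → ℕ
  companion zero = 0
  companion (suc y) = if isEven y then ⌊ y /2⌋ else suc (suc (double (partner ⌊ y /2⌋)))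

  row : ℕ → List ℕ
  row y = companion y ∷ suc (double y) ∷ []

  diag : ℕ → List ℕ
  diag zero = 0 ∷ 2 ∷ []
  diag (suc d) = if isEven d then double ⌊ d /2⌋ ∷ []
                 else suc (double ⌊ d /2⌋) ∷ suc (suc (double (A (suc ⌊ d /2⌋)))) ∷ []

  companion-odd : ∀ n → companion (suc (double n)) ≡ n
  companion-odd n rewrite isEven-double n = ⌊double/2⌋ n

  companion-even : ∀ b → companion (suc (suc (double b))) ≡ suc (suc (double (partner b)))
  companion-even b rewrite isEven-1+double b | ⌊1+double/2⌋ b = refl

  row-odd : ∀ n → row (suc (double n)) ≡ n ∷ suc (double (suc (double n))) ∷ []
  row-odd n = cong (_∷ suc (double (suc (double n))) ∷ []) (companion-odd n)

  row-even : ∀ b → row (suc (suc (double b))) ≡ suc (suc (double (partner b))) ∷ suc (double (suc (suc (double b)))) ∷ []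
  row-even b = cong (_∷ suc (double (suc (suc (double b)))) ∷ []) (companion-even b)

  diag-odd : ∀ j → diag (suc (double j)) ≡ double j ∷ []
  diag-odd j rewrite isEven-double j | ⌊double/2⌋ j = refl

  diag-even : ∀ j → diag (suc (suc (double j))) ≡ suc (double j) ∷ suc (suc (double (A (suc j)))) ∷ []
  diag-even j rewrite isEven-1+double j | ⌊1+double/2⌋ j = refl

  ∈-≡ : ∀ {x : ℕ} {xs ys} → xs ≡ ys → x ∈ xs → x ∈ ys
  ∈-≡ refl x∈ = x∈

  row-sym : ∀ {x y} → x ∈ row y → y ∈ row x
  row-sym {x} {y} x∈ with shape y
  row-sym (here refl) | zero = here refl
  row-sym (there (here refl)) | zero = here refl
  ... | odd n with ∈-pair⁻ (∈-≡ (row-odd n) x∈)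
  ...   | inj₁ refl = there (here refl)
  ...   | inj₂ refl = ∈-≡ (sym (row-odd (suc (double n)))) (here refl)
  row-sym x∈ | even⁺ b with ∈-pair⁻ (∈-≡ (row-even b) x∈)
  ...   | inj₁ refl = ∈-≡ (sym (row-even (partner b))) (here (cong (suc ∘ suc ∘ double) (sym (partner-involutive b))))
  ...   | inj₂ refl = ∈-≡ (sym (row-odd (suc (suc (double b))))) (here refl)

  private
    2j+[2j+1]≡ : ∀ j → (j + j) + suc (j + j) ≡ suc ((j + j) + (j + j))
    2j+[2j+1]≡ = solve-∀

    [2j+1]+[2j+2]≡ : ∀ j → suc (j + j) + suc (suc (j + j)) ≡ suc (suc (j + j) + suc (j + j))
    [2j+1]+[2j+2]≡ = solve-∀

    [2a+2]+[2j+2]≡ : ∀ a j → suc (suc (a + a)) + suc (suc (j + j)) ≡ suc (suc ((a + suc j) + (a + suc j)))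
    [2a+2]+[2j+2]≡ = solve-∀

    [2p+2]+2m≡ : ∀ p m → suc (suc (p + p)) + (m + m) ≡ suc (suc ((p + m) + (p + m)))
    [2p+2]+2m≡ = solve-∀

  diag⇒row : ∀ {a d} → a ∈ diag d → a ∈ row (a + d)
  diag⇒row {a} {d} a∈ with shape d
  diag⇒row (here refl) | zero = here refl
  diag⇒row (there (here refl)) | zero = here (cong (suc ∘ suc ∘ double) (sym partner-0))
  ... | odd j with ∈-≡ (diag-odd j) a∈
  ...   | here refl = subst (λ y → double j ∈ row y) (sym (2j+[2j+1]≡ j)) (∈-≡ (sym (row-odd (double j))) (here refl))
  diag⇒row a∈ | even⁺ j with ∈-pair⁻ (∈-≡ (diag-even j) a∈)
  ...   | inj₁ refl = subst (λ y → suc (double j) ∈ row y) (sym ([2j+1]+[2j+2]≡ j)) (∈-≡ (sym (row-odd (suc (double j)))) (here refl))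
  ...   | inj₂ refl = subst (λ y → suc (suc (double (A (suc j)))) ∈ row y) (sym ([2a+2]+[2j+2]≡ (A (suc j)) j))
                        (∈-≡ (sym (row-even (B (suc j)))) (here (cong (suc ∘ suc ∘ double) (sym (partner-B (suc j))))))

  ∈diag-suc : ∀ n → n ∈ diag (suc n)
  ∈diag-suc n with shape n
  ... | zero = here refl
  ... | odd j = ∈-≡ (sym (diag-even j)) (here refl)
  ... | even⁺ b = subst (λ n → n ∈ diag (suc n)) (cong suc (+-suc b b)) (∈-≡ (sym (diag-odd (suc b))) (here refl))

  2A+2∈diag : ∀ m → suc (suc (double (A m))) ∈ diag (double m)
  2A+2∈diag zero = there (here (cong (suc ∘ suc ∘ double) A-0))
  2A+2∈diag (suc j) = subst (λ d → suc (suc (double (A (suc j)))) ∈ diag d) (cong suc (sym (+-suc j j)))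
                        (∈-≡ (sym (diag-even j)) (there (here refl)))

  row⇒diag : ∀ {a d} → a ∈ row (a + d) → a ∈ diag d
  row⇒diag {a} {d} a∈ with a + d in a+d≡
  ... | y with a∈
  ...   | there (here refl) = contradiction (≤-trans (m≤m+n _ d) (≤-reflexive a+d≡)) (<⇒≱ (s≤s (m≤m+n y y)))
  ...   | here refl with shape y
  ...     | zero with refl ← m+n≡0⇒n≡0 a a+d≡ = here refl
  ...     | odd n rewrite companion-odd n | +-cancelˡ-≡ n d (suc n) (trans a+d≡ (sym (+-suc n n))) = ∈diag-suc n
  ...     | even⁺ b = subst (_∈ diag d) (sym (companion-even b)) $
                        subst₂ (λ s t → suc (suc (double s)) ∈ diag t) (sym p≡A) (sym d≡2m) (2A+2∈diag m)
    where
      p = partner b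
      a+d≡′ : suc (suc (double p)) + d ≡ suc (suc (double b))
      a+d≡′ = trans (cong (_+ d) (sym (companion-even b))) a+d≡
      p≤b : p ≤ b
      p≤b = double-cancel-≤ (≤-pred (≤-pred (subst (suc (suc (double p)) ≤_) a+d≡′ (m≤m+n _ d))))
      m = b ∸ p
      b≡p+m : b ≡ p + m
      b≡p+m = sym (m+[n∸m]≡n p≤b)
      p≡A : p ≡ A m
      p≡A = pair-offset⇒A (subst (WythoffPair p) b≡p+m (pair-sym (pair-partner b)))
      d≡2m : d ≡ double m
      d≡2m = +-cancelˡ-≡ (suc (suc (double p))) d (double m)
               (trans a+d≡′ (trans (cong (suc ∘ suc ∘ double) b≡p+m) (sym ([2p+2]+2m≡ p m))))

  row-unique : ∀ y → Unique (row y)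
  row-unique y = (companion≢ (shape y) ∷ []) ∷ [] ∷ []
    where
      companion≢ : ∀ {y} → Shape y → companion y ≢ suc (double y)
      companion≢ zero ()
      companion≢ (odd n) eq = <⇒≢ (≤-<-trans (m≤m+n n n) (s≤s (≤-trans (n≤1+n _) (m≤m+n _ _)))) (trans (sym (companion-odd n)) eq)
      companion≢ (even⁺ b) eq = 2+double≢1+double (partner b) (suc (suc (double b))) (trans (sym (companion-even b)) eq)

  diag-unique : ∀ d → Unique (diag d)
  diag-unique d with shape d
  ... | zero = ((λ ()) ∷ []) ∷ [] ∷ []
  ... | odd j = subst Unique (sym (diag-odd j)) ([] ∷ [])
  ... | even⁺ j = subst Unique (sym (diag-even j)) (((2+double≢1+double (A (suc j)) j ∘ sym) ∷ []) ∷ [] ∷ [])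

  open RowDiagonalSet row diag row-sym diag⇒row row⇒diag row-unique diag-unique public

  #below-row : ∀ x y → x ≤ y → #below x (row y) ≡ 𝟙[ companion y < x ]
  #below-row x y x≤y rewrite 𝟙[<]≡0 {suc (double y)} {x} (≤-trans x≤y (≤-trans (m≤m+n y y) (n≤1+n _))) = +-identityʳ _

  #below-column : ∀ y x → #below y (row x) ≡ 𝟙[ companion x < y ] + 𝟙[ suc (double x) < y ]
  #below-column y x = cong (𝟙[ companion x < y ] +_) (+-identityʳ _)

  #below-row-odd : ∀ x n → x ≤ suc (double n) → #below x (row (suc (double n))) ≡ 𝟙[ n < x ]
  #below-row-odd x n x≤ = trans (#below-row x _ x≤) (cong 𝟙[_< x ] (companion-odd n))

  #below-row-even : ∀ x b → x ≤ suc (suc (double b)) → #below x (row (suc (suc (double b)))) ≡ 𝟙[ suc (suc (double (partner b))) < x ]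
  #below-row-even x b x≤ = trans (#below-row x _ x≤) (cong 𝟙[_< x ] (companion-even b))

  #below-column-odd : ∀ y n → #below y (row (suc (double n))) ≡ 𝟙[ n < y ] + 𝟙[ suc (double (suc (double n))) < y ]
  #below-column-odd y n = trans (#below-column y (suc (double n))) (cong (_+ 𝟙[ suc (double (suc (double n))) < y ]) (cong 𝟙[_< y ] (companion-odd n)))

  #below-column-even : ∀ y b → #below y (row (suc (suc (double b)))) ≡ 𝟙[ suc (suc (double (partner b))) < y ] + 𝟙[ suc (double (suc (suc (double b)))) < y ]
  #below-column-even y b = trans (#below-column y (suc (suc (double b)))) (cong (_+ 𝟙[ suc (double (suc (suc (double b)))) < y ]) (cong 𝟙[_< y ] (companion-even b)))

  #below-diag-odd : ∀ x j → #below x (diag (suc (double j))) ≡ 𝟙[ double j < x ]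
  #below-diag-odd x j rewrite diag-odd j = +-identityʳ _

  #below-diag-even : ∀ x j → #below x (diag (suc (suc (double j)))) ≡ 𝟙[ suc (double j) < x ] + 𝟙[ suc (suc (double (A (suc j)))) < x ]
  #below-diag-even x j rewrite diag-even j = cong (𝟙[ suc (double j) < x ] +_) (+-identityʳ _)

  count-at : ∀ x d y → x + d ≡ y → count (x , x + d) ≡ #below x (row y) + #below y (row x) + #below x (diag d)
  count-at x d y refl = count-offset x d

  >1-by-row-column : ∀ {r c d} → 1 ≤ r → 1 ≤ c → 1 < r + c + d
  >1-by-row-column {r} {c} {d} 1≤r 1≤c = ≤-trans (+-mono-≤ 1≤r 1≤c) (m≤m+n (r + c) d)

  >1-by-column-diag : ∀ {r c d} → 1 ≤ c → 1 ≤ d → 1 < r + c + d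
  >1-by-column-diag {r} {c} {d} 1≤c 1≤d = ≤-trans (+-mono-≤ 1≤c 1≤d) (+-monoˡ-≤ d (m≤n+m c r))

  >1-by-row-diag : ∀ {r c d} → 1 ≤ r → 1 ≤ d → 1 < r + c + d
  >1-by-row-diag {r} {c} {d} 1≤r 1≤d = ≤-trans (+-mono-≤ 1≤r 1≤d) (+-monoˡ-≤ d (m≤m+n r c))

  >1-by-column : ∀ {r c d} → 2 ≤ c → 1 < r + c + d
  >1-by-column {r} {c} {d} 2≤c = ≤-trans 2≤c (≤-trans (m≤n+m c r) (m≤m+n (r + c) d))

  >1-by-diag : ∀ {r c d} → 2 ≤ d → 1 < r + c + d
  >1-by-diag {r} {c} {d} 2≤d = ≤-trans 2≤d (m≤n+m d (r + c))

  0∉row : ∀ y → 2 ≤ y → 0 ∉ row y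
  0∉row y 2≤y 0∈ with shape y | 0∈
  ... | zero | _ = contradiction 2≤y (λ ())
  ... | odd n | here 0≡ = contradiction (subst (λ k → 2 ≤ suc (double k)) (trans (sym (companion-odd n)) (sym 0≡)) 2≤y) (λ { (s≤s ()) })
  ... | even⁺ b | here 0≡ = contradiction (trans 0≡ (companion-even b)) (λ ())
  ... | _ | there (here ())

  fits-column-0 : ∀ d → CountFits 1 (0 , d)
  fits-column-0 zero = Q-fits {p = 0 , 0} (here refl) z≤n
  fits-column-0 (suc zero) = Q-fits {p = 0 , 1} (here refl) ≤-refl
  fits-column-0 (suc (suc d)) = ¬Q-fits {p = 0 , suc (suc d)} (0∉row (suc (suc d)) (s≤s (s≤s z≤n)))
    (≤-reflexive (sym (trans (count-offset 0 (suc (suc d))) (cong (2 +_) (#below-0 (diag (suc (suc d))))))))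

  fits-diagonal : ∀ x → 1 ≤ x → CountFits 1 (x , x + 0)
  fits-diagonal x 1≤x with shape x
  ... | odd n = ¬Q-fits {p = x , x + 0} ¬Q (subst (1 <_) (sym (count-at x 0 x (+-identityʳ x))) (>1-by-row-column row-hit row-hit))
    where
      row-hit : 1 ≤ #below x (row x)
      row-hit = subst (1 ≤_) (sym (#below-column-odd x n)) (≤-trans (𝟙[<]≥1 {n} {x} (s≤s (m≤m+n n n))) (m≤m+n _ _))
      ¬Q : ¬ Q (x , x + 0)
      ¬Q Q-x with ∈-pair⁻ (row⇒diag Q-x)
      ... | inj₁ ()
      ... | inj₂ x≡2 = double≢1+double 1 n (sym x≡2)
  ... | even⁺ zero = Q-fits {p = 2 , 2} (diag⇒row {d = 0} (there (here refl))) ≤-refl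
  ... | even⁺ (suc a) = ¬Q-fits {p = x , x + 0} ¬Q
          (subst (1 <_) (sym (count-at x 0 x (+-identityʳ x))) (>1-by-diag {#below x (row x)} {#below x (row x)} (s≤s (s≤s z≤n))))
    where
      ¬Q : ¬ Q (x , x + 0)
      ¬Q Q-x with ∈-pair⁻ (row⇒diag Q-x)
      ... | inj₁ ()
      ... | inj₂ x≡2 = 1+n≢0 {a + suc a} (suc-injective (suc-injective x≡2))

  private
    ≤-offset : ∀ {a b} k → a + k ≡ b → a ≤ b
    ≤-offset k refl = m≤m+n _ k

    <-offset : ∀ {a b} k → suc (a + k) ≡ b → a < b
    <-offset k refl = s≤s (m≤m+n _ k)

    split-< : ∀ {m n} → m < n → ∃[ t ] n ≡ suc (m + t)
    split-< m<n = let t , m+t≡n = m≤n⇒∃[o]m+o≡n m<n in t , sym m+t≡n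

    split-≤ : ∀ {m n} → m ≤ n → ∃[ t ] n ≡ m + t
    split-≤ m≤n = let t , m+t≡n = m≤n⇒∃[o]m+o≡n m≤n in t , sym m+t≡n

    [2n+1]+[2j+1]≡ : ∀ n j → suc (n + n) + suc (j + j) ≡ suc (suc ((n + j) + (n + j)))
    [2n+1]+[2j+1]≡ = solve-∀

    odd-odd-far≡ : ∀ n t → suc (suc ((suc (n + n) + suc (n + n)) + (t + t))) ≡ suc (suc ((n + suc (n + t)) + (n + suc (n + t))))
    odd-odd-far≡ = solve-∀

  fits-odd-odd : ∀ n j → CountFits 1 (suc (double n) , suc (double n) + suc (double j))
  fits-odd-odd n j = ¬Q-fits {p = x , x + d} ¬Q (subst (1 <_) (sym (count-at x d Y ([2n+1]+[2j+1]≡ n j))) many)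
    where
      x = suc (double n)
      d = suc (double j)
      Y = suc (suc (double (n + j)))
      ¬Q : ¬ Q (x , x + d)
      ¬Q Q-p with ∈-≡ (diag-odd j) (row⇒diag Q-p)
      ... | here x≡ = double≢1+double j n (sym x≡)
      n<Y : n < Y
      n<Y = s≤s (≤-trans (m≤m+n n j) (≤-trans (m≤m+n (n + j) (n + j)) (n≤1+n _)))
      many : 1 < #below x (row Y) + #below Y (row x) + #below x (diag d)
      many with j ≤? n
      ... | yes j≤n = >1-by-column-diag {#below x (row Y)}
                        (subst (1 ≤_) (sym (#below-column-odd Y n)) (≤-trans (𝟙[<]≥1 n<Y) (m≤m+n _ _)))
                        (subst (1 ≤_) (sym (#below-diag-odd x j)) (𝟙[<]≥1 (s≤s (double-mono-≤ j≤n))))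
      ... | no j≰n = >1-by-column {#below x (row Y)} {d = #below x (diag d)}
                        (subst (2 ≤_) (sym (#below-column-odd Y n)) (+-mono-≤ (𝟙[<]≥1 n<Y) (𝟙[<]≥1 2x+1<Y)))
        where
          t = proj₁ (split-< (≰⇒> j≰n))
          2x+1<Y : suc (double x) < Y
          2x+1<Y = <-offset (t + t) (trans (odd-odd-far≡ n t) (cong (λ s → suc (suc (double (n + s)))) (sym (proj₂ (split-< (≰⇒> j≰n))))))

  private
    [2a+2]+[2j+1]≡ : ∀ a j → suc (suc (a + a)) + suc (j + j) ≡ suc (suc (a + j) + suc (a + j))
    [2a+2]+[2j+1]≡ = solve-∀

    a+1+a≡ : ∀ a → suc (a + suc a) ≡ suc (suc (a + a))
    a+1+a≡ = solve-∀

    [a+1]+[a+1]≡ : ∀ a → suc a + suc a ≡ suc (suc (a + a))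
    [a+1]+[a+1]≡ = solve-∀

    even-odd-far≡ : ∀ a t → suc (suc ((suc (suc (a + a)) + suc (suc (a + a))) + suc (t + t))) ≡ suc (suc (a + suc (suc (a + t))) + suc (a + suc (suc (a + t))))
    even-odd-far≡ = solve-∀

    even-odd-far′≡ : ∀ a t → suc (suc (suc ((a + a) + (a + a)) + suc (suc (suc (suc (t + t)))))) ≡ suc (suc (a + suc (suc (a + t))) + suc (a + suc (suc (a + t))))
    even-odd-far′≡ = solve-∀

  fits-even-odd-P : ∀ a → CountFits 1 (suc (suc (double a)) , suc (suc (double a)) + suc (double (suc a)))
  fits-even-odd-P a = Q-fits {p = x , x + d} Q-p (subst (_≤ 1) (sym (count-at x d Y ([2a+2]+[2j+1]≡ a (suc a)))) few)
    where
      x = suc (suc (double a))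
      d = suc (double (suc a))
      Y = suc (double (suc (a + suc a)))
      Q-p : Q (x , x + d)
      Q-p = diag⇒row (∈-≡ (sym (diag-odd (suc a))) (here (sym ([a+1]+[a+1]≡ a))))
      x≤Y : x ≤ Y
      x≤Y = ≤-trans (≤-reflexive (sym (a+1+a≡ a))) (≤-trans (m≤m+n _ _) (n≤1+n _))
      few : #below x (row Y) + #below Y (row x) + #below x (diag d) ≤ 1
      few rewrite #below-row-odd x (suc (a + suc a)) x≤Y | #below-column-even Y a | #below-diag-odd x (suc a) =
        +-mono-≤ (+-mono-≤ (𝟙[<]≤0 (≤-reflexive (sym (a+1+a≡ a))))
                           (+-mono-≤ (𝟙[<]≤1 (suc (suc (double (partner a)))) Y) (𝟙[<]≤0 (≤-reflexive (cong (suc ∘ double) (a+1+a≡ a))))))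
                 (𝟙[<]≤0 (≤-reflexive (sym ([a+1]+[a+1]≡ a))))

  fits-even-odd-near : ∀ a j → j < suc a → CountFits 1 (suc (suc (double a)) , suc (suc (double a)) + suc (double j))
  fits-even-odd-near a j j<a+1 = ¬Q-fits {p = x , x + d} ¬Q (subst (1 <_) (sym (count-at x d Y ([2a+2]+[2j+1]≡ a j))) many)
    where
      x = suc (suc (double a))
      d = suc (double j)
      Y = suc (double (suc (a + j)))
      ¬Q : ¬ Q (x , x + d)
      ¬Q Q-p with ∈-≡ (diag-odd j) (row⇒diag Q-p)
      ... | here x≡ = <⇒≢ j<a+1 (double-injective (trans (sym x≡) (sym ([a+1]+[a+1]≡ a))))
      many : 1 < #below x (row Y) + #below Y (row x) + #below x (diag d)
      many rewrite #below-row-odd x (suc (a + j)) (≤-offset (suc (j + j)) ([2a+2]+[2j+1]≡ a j)) | #below-diag-odd x j =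
        >1-by-row-diag {𝟙[ suc (a + j) < x ]} {#below Y (row x)} (𝟙[<]≥1 (s≤s (s≤s (+-monoʳ-≤ a (≤-pred j<a+1)))))
                                                                  (𝟙[<]≥1 (s≤s (≤-trans (double-mono-≤ (≤-pred j<a+1)) (n≤1+n _))))

  fits-even-odd-far : ∀ a j → suc a < j → CountFits 1 (suc (suc (double a)) , suc (suc (double a)) + suc (double j))
  fits-even-odd-far a j a+1<j = ¬Q-fits {p = x , x + d} ¬Q (subst (1 <_) (sym (count-at x d Y ([2a+2]+[2j+1]≡ a j))) many)
    where
      x = suc (suc (double a))
      d = suc (double j)
      Y = suc (double (suc (a + j)))
      ¬Q : ¬ Q (x , x + d)
      ¬Q Q-p with ∈-≡ (diag-odd j) (row⇒diag Q-p)
      ... | here x≡ = <⇒≢ a+1<j (sym (double-injective (trans (sym x≡) (sym ([a+1]+[a+1]≡ a)))))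
      t = proj₁ (split-< a+1<j)
      j≡ = proj₂ (split-< a+1<j)
      many : 1 < #below x (row Y) + #below Y (row x) + #below x (diag d)
      many rewrite #below-column-even Y a = >1-by-column {#below x (row Y)} {d = #below x (diag d)} (+-mono-≤ (𝟙[<]≥1 partner<Y) (𝟙[<]≥1 2x+1<Y))
        where
          2x+1<Y : suc (double x) < Y
          2x+1<Y = <-offset (suc (t + t)) (trans (even-odd-far≡ a t) (cong (λ s → suc (suc (a + s) + suc (a + s))) (sym j≡)))
          partner<Y : suc (suc (double (partner a))) < Y
          partner<Y = ≤-<-trans (s≤s (s≤s (double-mono-≤ (partner≤double a))))
                        (<-offset (suc (suc (suc (suc (t + t))))) (trans (even-odd-far′≡ a t) (cong (λ s → suc (suc (a + s) + suc (a + s))) (sym j≡))))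

  fits-even-odd : ∀ a j → CountFits 1 (suc (suc (double a)) , suc (suc (double a)) + suc (double j))
  fits-even-odd a j with <-cmp j (suc a)
  ... | tri≈ _ refl _ = fits-even-odd-P a
  ... | tri< j<a+1 _ _ = fits-even-odd-near a j j<a+1
  ... | tri> _ _ a+1<j = fits-even-odd-far a j a+1<j

  private
    [2n+1]+[2j+2]≡ : ∀ n j → suc (n + n) + suc (suc (j + j)) ≡ suc (suc (n + j) + suc (n + j))
    [2n+1]+[2j+2]≡ = solve-∀

    odd-even-far≡ : ∀ n t → suc (suc ((suc (n + n) + suc (n + n)) + suc (t + t))) ≡ suc (suc (n + suc (n + t)) + suc (n + suc (n + t)))
    odd-even-far≡ = solve-∀

  fits-odd-even-P : ∀ n → CountFits 1 (suc (double n) , suc (double n) + suc (suc (double n)))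
  fits-odd-even-P n = Q-fits {p = x , x + d} Q-p (subst (_≤ 1) (sym (count-at x d Y ([2n+1]+[2j+2]≡ n n))) few)
    where
      x = suc (double n)
      d = suc (suc (double n))
      Y = suc (double (suc (n + n)))
      Q-p : Q (x , x + d)
      Q-p = diag⇒row (∈-≡ (sym (diag-even n)) (here refl))
      x≤2A+2 : x ≤ suc (suc (double (A (suc n))))
      x≤2A+2 = ≤-trans (n≤1+n _) (s≤s (s≤s (double-mono-≤ (≤-trans (n≤1+n n) (n≤A (suc n))))))
      few : #below x (row Y) + #below Y (row x) + #below x (diag d) ≤ 1
      few rewrite #below-row-odd x (suc (n + n)) (≤-offset (suc (suc (n + n))) ([2n+1]+[2j+2]≡ n n))
                | #below-column-odd Y n | #below-diag-even x n =
        +-mono-≤ (+-mono-≤ (𝟙[<]≤0 {suc (n + n)} {x} ≤-refl) (+-mono-≤ (𝟙[<]≤1 n Y) (𝟙[<]≤0 {suc (double x)} {Y} ≤-refl)))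
                 (+-mono-≤ (𝟙[<]≤0 {suc (double n)} {x} ≤-refl) (𝟙[<]≤0 x≤2A+2))

  fits-odd-even-far : ∀ n j → n < j → CountFits 1 (suc (double n) , suc (double n) + suc (suc (double j)))
  fits-odd-even-far n j n<j = ¬Q-fits {p = x , x + d} ¬Q (subst (1 <_) (sym (count-at x d Y ([2n+1]+[2j+2]≡ n j))) many)
    where
      x = suc (double n)
      d = suc (suc (double j))
      Y = suc (double (suc (n + j)))
      ¬Q : ¬ Q (x , x + d)
      ¬Q Q-p with ∈-pair⁻ (∈-≡ (diag-even j) (row⇒diag Q-p))
      ... | inj₁ x≡ = <⇒≢ n<j (double-injective (suc-injective x≡))
      ... | inj₂ x≡ = 2+double≢1+double (A (suc j)) n (sym x≡)
      n<Y : n < Y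
      n<Y = s≤s (≤-trans (n≤1+n n) (≤-trans (s≤s (m≤m+n n j)) (m≤m+n _ _)))
      t = proj₁ (split-< n<j)
      2x+1<Y : suc (double x) < Y
      2x+1<Y = <-offset (suc (t + t)) (trans (odd-even-far≡ n t) (cong (λ s → suc (suc (n + s) + suc (n + s))) (sym (proj₂ (split-< n<j)))))
      many : 1 < #below x (row Y) + #below Y (row x) + #below x (diag d)
      many = >1-by-column {#below x (row Y)} {d = #below x (diag d)}
               (subst (2 ≤_) (sym (#below-column-odd Y n)) (+-mono-≤ (𝟙[<]≥1 n<Y) (𝟙[<]≥1 2x+1<Y)))

  fits-odd-even-near : ∀ n j → j < n → CountFits 1 (suc (double n) , suc (double n) + suc (suc (double j)))
  fits-odd-even-near n j j<n = ¬Q-fits {p = x , x + d} ¬Q (subst (1 <_) (sym (count-at x d Y ([2n+1]+[2j+2]≡ n j))) many)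
    where
      x = suc (double n)
      d = suc (suc (double j))
      Y = suc (double (suc (n + j)))
      ¬Q : ¬ Q (x , x + d)
      ¬Q Q-p with ∈-pair⁻ (∈-≡ (diag-even j) (row⇒diag Q-p))
      ... | inj₁ x≡ = <⇒≢ j<n (sym (double-injective (suc-injective x≡)))
      ... | inj₂ x≡ = 2+double≢1+double (A (suc j)) n (sym x≡)
      n<Y : n < Y
      n<Y = s≤s (≤-trans (n≤1+n n) (≤-trans (s≤s (m≤m+n n j)) (m≤m+n _ _)))
      many : 1 < #below x (row Y) + #below Y (row x) + #below x (diag d)
      many rewrite #below-row-odd x (suc (n + j)) (≤-offset (suc (suc (j + j))) ([2n+1]+[2j+2]≡ n j)) | #below-column-odd Y n =
        >1-by-row-column {𝟙[ suc (n + j) < x ]} {𝟙[ n < Y ] + 𝟙[ suc (double x) < Y ]}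
          (𝟙[<]≥1 (s≤s (+-monoʳ-< n j<n))) (≤-trans (𝟙[<]≥1 n<Y) (m≤m+n _ _))

  fits-odd-even : ∀ n j → CountFits 1 (suc (double n) , suc (double n) + suc (suc (double j)))
  fits-odd-even n j with <-cmp n j
  ... | tri≈ _ refl _ = fits-odd-even-P n
  ... | tri< n<j _ _ = fits-odd-even-far n j n<j
  ... | tri> _ _ j<n = fits-odd-even-near n j j<n

  private
    even-even-near≡ : ∀ j t → suc (suc (suc ((j + t) + (j + t))) + suc (suc ((j + t) + (j + t)))) ≡ suc (suc (((j + t) + suc j) + ((j + t) + suc j))) + suc (t + t)
    even-even-near≡ = solve-∀

    even-even-diag≡ : ∀ a t → suc ((suc a + t) + (suc a + t)) ≡ suc (suc (a + a)) + suc (t + t)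
    even-even-diag≡ = solve-∀

    even-even-far≡ : ∀ a t → suc (suc ((a + suc (suc a + t)) + (a + suc (suc a + t)))) ≡ suc (suc (suc (suc (a + a)) + suc (suc (a + a))) + (t + t))
    even-even-far≡ = solve-∀

    2b+2≤2x+1 : ∀ a j t → a ≡ j + t → suc (suc (double (a + suc j))) ≤ suc (double (suc (suc (double a))))
    2b+2≤2x+1 .(j + t) j t refl = ≤-offset (suc (t + t)) (sym (even-even-near≡ j t))

    x≤2j+1 : ∀ a j t → j ≡ suc a + t → suc (suc (double a)) ≤ suc (double j)
    x≤2j+1 a .(suc a + t) t refl = ≤-offset (suc (t + t)) (sym (even-even-diag≡ a t))

    2x+1<2b+2 : ∀ a j t → j ≡ suc a + t → suc (double (suc (suc (double a)))) < suc (suc (double (a + suc j)))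
    2x+1<2b+2 a .(suc a + t) t refl = <-offset (t + t) (sym (even-even-far≡ a t))

    2+double-mono-< : ∀ {p q} → p < q → suc (suc (double p)) < suc (suc (double q))
    2+double-mono-< p<q = s≤s (s≤s (double-mono-< p<q))

  fits-even-even-P : ∀ a j → a ≡ A (suc j) → CountFits 1 (suc (suc (double a)) , suc (suc (double a)) + suc (suc (double j)))
  fits-even-even-P a j a≡A = Q-fits {p = x , x + d} Q-p (subst (_≤ 1) (sym (count-at x d Y ([2a+2]+[2j+2]≡ a j))) few)
    where
      x = suc (suc (double a))
      d = suc (suc (double j))
      b = a + suc j
      Y = suc (suc (double b))
      Q-p : Q (x , x + d)
      Q-p = diag⇒row (∈-≡ (sym (diag-even j)) (there (here (cong (suc ∘ suc ∘ double) a≡A))))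
      partner-a : partner a ≡ b
      partner-a = partner-unique (suc j , inj₁ (a≡A , cong (_+ suc j) a≡A))
      partner-b : partner b ≡ a
      partner-b = trans (cong partner (sym partner-a)) (partner-involutive a)
      x≤2A+2 : x ≤ suc (suc (double (A (suc j))))
      x≤2A+2 = ≤-reflexive (cong (suc ∘ suc ∘ double) a≡A)
      few : #below x (row Y) + #below Y (row x) + #below x (diag d) ≤ 1
      few rewrite #below-row-even x b (≤-offset (suc (suc (j + j))) ([2a+2]+[2j+2]≡ a j))
                | #below-column-even Y a | #below-diag-even x j | partner-a | partner-b with j ≤? a
      ... | yes j≤a = +-mono-≤ (+-mono-≤ (𝟙[<]≤0 {x} {x} ≤-refl) (+-mono-≤ (𝟙[<]≤0 {Y} {Y} ≤-refl)
                                 (𝟙[<]≤0 (2b+2≤2x+1 a j (proj₁ (split-≤ j≤a)) (proj₂ (split-≤ j≤a))))))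
                               (+-mono-≤ (𝟙[<]≤1 (suc (double j)) x) (𝟙[<]≤0 x≤2A+2))
      ... | no j≰a = +-mono-≤ (+-mono-≤ (𝟙[<]≤0 {x} {x} ≤-refl) (+-mono-≤ (𝟙[<]≤0 {Y} {Y} ≤-refl) (𝟙[<]≤1 (suc (double x)) Y)))
                              (+-mono-≤ (𝟙[<]≤0 (x≤2j+1 a j (proj₁ (split-< (≰⇒> j≰a))) (proj₂ (split-< (≰⇒> j≰a)))))
                                        (𝟙[<]≤0 x≤2A+2))

  fits-even-even-N : ∀ a j → a ≢ A (suc j) → CountFits 1 (suc (suc (double a)) , suc (suc (double a)) + suc (suc (double j)))
  fits-even-even-N a j a≢A = ¬Q-fits {p = x , x + d} ¬Q (subst (1 <_) (sym (count-at x d Y ([2a+2]+[2j+2]≡ a j))) many)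
    where
      x = suc (suc (double a))
      d = suc (suc (double j))
      b = a + suc j
      Y = suc (suc (double b))
      ¬Q : ¬ Q (x , x + d)
      ¬Q Q-p with ∈-pair⁻ (∈-≡ (diag-even j) (row⇒diag Q-p))
      ... | inj₁ x≡ = 2+double≢1+double a j x≡
      ... | inj₂ x≡ = a≢A (double-injective (suc-injective (suc-injective x≡)))
      partner-small-or-A-small : partner a < b ⊎ A (suc j) < a
      partner-small-or-A-small with partner a <? b | A (suc j) <? a
      ... | yes partner<b | _ = inj₁ partner<b
      ... | no _ | yes A<a = inj₂ A<a
      ... | no partner≮b | no A≮a = contradiction (pair-offset⇒A (subst (WythoffPair a) partner≡ (pair-partner a))) a≢A
        where partner≡ = partner-offset a (suc j) (s≤s z≤n) (≮⇒≥ partner≮b) (≮⇒≥ A≮a)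
      many : 1 < #below x (row Y) + #below Y (row x) + #below x (diag d)
      many rewrite #below-row-even x b (≤-offset (suc (suc (j + j))) ([2a+2]+[2j+2]≡ a j))
                 | #below-column-even Y a | #below-diag-even x j with j ≤? a | partner-small-or-A-small
      ... | yes j≤a | inj₁ partner<b =
        >1-by-column-diag {𝟙[ suc (suc (double (partner b))) < x ]}
          (≤-trans (𝟙[<]≥1 (2+double-mono-< partner<b)) (m≤m+n _ _)) (≤-trans (𝟙[<]≥1 2j+1<x) (m≤m+n _ _))
        where 2j+1<x = s≤s (s≤s (double-mono-≤ j≤a))
      ... | yes j≤a | inj₂ A<a =
        >1-by-diag {𝟙[ suc (suc (double (partner b))) < x ]} {𝟙[ suc (suc (double (partner a))) < Y ] + 𝟙[ suc (double x) < Y ]}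
          (+-mono-≤ (𝟙[<]≥1 2j+1<x) (𝟙[<]≥1 (2+double-mono-< A<a)))
        where 2j+1<x = s≤s (s≤s (double-mono-≤ j≤a))
      ... | no j≰a | inj₁ partner<b =
        >1-by-column {𝟙[ suc (suc (double (partner b))) < x ]} {d = 𝟙[ suc (double j) < x ] + 𝟙[ suc (suc (double (A (suc j)))) < x ]}
          (+-mono-≤ (𝟙[<]≥1 (2+double-mono-< partner<b)) (𝟙[<]≥1 (2x+1<2b+2 a j (proj₁ (split-< (≰⇒> j≰a))) (proj₂ (split-< (≰⇒> j≰a))))))
      ... | no j≰a | inj₂ A<a =
        >1-by-column-diag {𝟙[ suc (suc (double (partner b))) < x ]}
          (≤-trans (𝟙[<]≥1 (2x+1<2b+2 a j (proj₁ (split-< (≰⇒> j≰a))) (proj₂ (split-< (≰⇒> j≰a))))) (m≤n+m _ _))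
          (≤-trans (𝟙[<]≥1 (2+double-mono-< A<a)) (m≤n+m _ _))

  fits-even-even : ∀ a j → CountFits 1 (suc (suc (double a)) , suc (suc (double a)) + suc (suc (double j)))
  fits-even-even a j with a ≟ A (suc j)
  ... | yes a≡A = fits-even-even-P a j a≡A
  ... | no a≢A = fits-even-even-N a j a≢A

  count-fits : ∀ x d → CountFits 1 (x , x + d)
  count-fits x d with shape x | shape d
  ... | zero | _ = fits-column-0 d
  ... | odd n | zero = fits-diagonal (suc (double n)) (s≤s z≤n)
  ... | even⁺ a | zero = fits-diagonal (suc (suc (double a))) (s≤s z≤n)
  ... | odd n | odd j = fits-odd-odd n j
  ... | even⁺ a | odd j = fits-even-odd a j
  ... | odd n | even⁺ j = fits-odd-even n j
  ... | even⁺ a | even⁺ j = fits-even-even a j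

  open Blocking 1 count-fits

  count-even-diagonal : ∀ c → Lower c → count (suc (suc (double c)) , suc (suc (double c))) ≡ 2
  count-even-diagonal zero lower = contradiction partner-0 (<⇒≢ lower ∘ sym)
  count-even-diagonal (suc c) lower =
    trans (count-diagonal x) (cong (λ r → r + r + 2) (trans (#below-row-even x (suc c) ≤-refl) (𝟙[<]≡0 x≤2p+2)))
    where
      x = suc (suc (double (suc c)))
      x≤2p+2 : x ≤ suc (suc (double (partner (suc c))))
      x≤2p+2 = s≤s (s≤s (double-mono-≤ (<⇒≤ lower)))

  private
    [2N+1]+[2j+1]≡ : ∀ N j → suc (N + N) + suc (j + j) ≡ suc (suc ((N + j) + (N + j)))
    [2N+1]+[2j+1]≡ = solve-∀

    2[N+j]+2≤2x+1 : ∀ j t → suc (suc (((j + t) + j) + ((j + t) + j))) + suc (t + t) ≡ suc (suc ((j + t) + (j + t)) + suc ((j + t) + (j + t)))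
    2[N+j]+2≤2x+1 = solve-∀

  count-odd-offset : ∀ N j → j ≤ N → Lower (N + j) → count (suc (double N) , suc (double N) + suc (double j)) ≡ 2
  count-odd-offset N j j≤N lower = trans (count-at x d Y ([2N+1]+[2j+1]≡ N j)) counted
    where
      x = suc (double N)
      d = suc (double j)
      Y = suc (suc (double (N + j)))
      Y≤2x+1 : Y ≤ suc (double x)
      Y≤2x+1 with t , refl ← split-≤ j≤N = ≤-offset (suc (t + t)) (2[N+j]+2≤2x+1 j t)
      counted : #below x (row Y) + #below Y (row x) + #below x (diag d) ≡ 2
      counted rewrite #below-row-even x (N + j) (≤-offset (suc (j + j)) ([2N+1]+[2j+1]≡ N j))
                    | #below-column-odd Y N | #below-diag-odd x j
                    | 𝟙[<]≡0 {suc (suc (double (partner (N + j))))} {x} (s≤s (≤-trans (n≤1+n _) (s≤s (double-mono-≤ (≤-trans (m≤m+n N j) (<⇒≤ lower))))))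
                    | 𝟙[<]≡1 {N} {Y} (s≤s (≤-trans (m≤m+n N j) (≤-trans (m≤m+n (N + j) (N + j)) (n≤1+n _))))
                    | 𝟙[<]≡0 {suc (double x)} {Y} Y≤2x+1
                    | 𝟙[<]≡1 {double j} {x} (s≤s (double-mono-≤ j≤N)) = refl

  private
    t+c+c≡ : ∀ t c → (t + c) + c ≡ c + c + t
    t+c+c≡ = solve-∀

    odd-target≡ : ∀ t c → suc ((t + c) + (t + c)) ∸ suc (t + t) ≡ c + c
    odd-target≡ t c = trans (cong (_∸ suc (t + t)) (e t c)) (m+n∸m≡n (suc (t + t)) (c + c))
      where e : ∀ t c → suc ((t + c) + (t + c)) ≡ suc (t + t) + (c + c)
            e = solve-∀

    odd-target′≡ : ∀ t c → (suc ((t + c) + (t + c)) + suc (c + c)) ∸ suc (t + t) ≡ suc ((c + c) + (c + c))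
    odd-target′≡ t c = trans (cong (_∸ suc (t + t)) (e t c)) (m+n∸m≡n (suc (t + t)) _)
      where e : ∀ t c → suc ((t + c) + (t + c)) + suc (c + c) ≡ suc (t + t) + suc ((c + c) + (c + c))
            e = solve-∀

  -- For i = 2t + 1 the witness is p = (x, x + 2c + 1) with x = 2(t + c) + 1, whose option
  -- p - (i, i) = (2c, 4c + 1) is a P-position.
  odd-diagonal-move : ∀ t c → Lower (c + c + t) → PSetsDiffer Wythoff (remove Wythoff (suc (double t) , suc (double t))) 2
  odd-diagonal-move t c lower =
    not-redundant (inj₂ (inj₂ (s≤s z≤n , refl))) i≤x (≤-trans i≤x (m≤m+n x d))
      (count-odd-offset (t + c) c (m≤n+m c t) (subst Lower (sym (t+c+c≡ t c)) lower))
      (subst₂ (λ a b → Q (a , b)) (sym (odd-target≡ t c)) (sym (odd-target′≡ t c))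
              (∈-≡ (sym (row-odd (double c))) (here refl)))
    where
      x = suc (double (t + c))
      d = suc (double c)
      i≤x : suc (double t) ≤ x
      i≤x = s≤s (double-mono-≤ (m≤m+n t c))

  -- For i = 2c + 2 the witness is (i, i), with option (0, 0), when c is lower, and
  -- (i + 2, i + 2), with option (2, 2), when c + 1 is.
  diagonal-move : ∀ {i} → Shape i → 1 ≤ i → PSetsDiffer Wythoff (remove Wythoff (i , i)) 2
  diagonal-move (odd t) _ with lower-every-other t
  ... | inj₁ lower = odd-diagonal-move t 0 lower
  ... | inj₂ (inj₁ lower) = odd-diagonal-move t 1 lower
  ... | inj₂ (inj₂ lower) = odd-diagonal-move t 2 lower
  diagonal-move {i} (even⁺ c) 1≤i with consecutive-lower c
  ... | inj₁ lower = not-redundant (inj₂ (inj₂ (1≤i , refl))) ≤-refl ≤-refl (count-even-diagonal c lower)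
                       (subst (λ a → Q (a , a)) (sym (n∸n≡0 i)) (here refl))
  ... | inj₂ lower = not-redundant (inj₂ (inj₂ (1≤i , refl))) i≤x i≤x (count-even-diagonal (suc c) lower)
                       (subst (λ a → Q (a , a)) (sym x∸i≡2) (diag⇒row {d = 0} (there (here refl))))
    where
      x = suc (suc (double (suc c)))
      x≡i+2 : x ≡ i + 2
      x≡i+2 = e c
        where e : ∀ c → suc (suc (suc c + suc c)) ≡ suc (suc (c + c)) + 2
              e = solve-∀
      i≤x : i ≤ x
      i≤x = ≤-offset 2 (sym x≡i+2)
      x∸i≡2 : x ∸ i ≡ 2
      x∸i≡2 = trans (cong (_∸ i) x≡i+2) (m+n∸m≡n i 2)
  diagonal-move zero ()

  no-redundant-move : ∀ m → Wythoff m → PSetsDiffer Wythoff (remove Wythoff m) 2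
  no-redundant-move (suc u , _) w@(inj₁ (_ , refl)) =
    not-redundant {y = 0} w (n≤1+n _) z≤n (cong (2 +_) (#below-0 (diag (suc (suc u)))))
      (subst (λ x → Q (x , 0)) (sym (m+n∸n≡m 1 u)) (there (here refl)))
  no-redundant-move (_ , suc v) w@(inj₂ (inj₁ (refl , _))) =
    not-redundant {x = 0} w z≤n (n≤1+n _) (cong (2 +_) (#below-0 (diag (suc (suc v)))))
      (subst (λ y → Q (0 , y)) (sym (m+n∸n≡m 1 v)) (here refl))
  no-redundant-move (suc u , _) (inj₂ (inj₂ (1≤i , refl))) = diagonal-move (shape (suc u)) 1≤i

theorem31 : (k : ℕ) → k ≡ 2 ⊎ k ≡ 3 →
    (m : Move) → Wythoff m → PSetsDiffer Wythoff (remove Wythoff m) k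
theorem31 .2 (inj₁ refl) = W².no-redundant-move
theorem31 .3 (inj₂ refl) = W³.no-redundant-move
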